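{- Let $\mathcal{T}=(\mathcal{V},\mathcal{E})$ be a finite tree with geodesic distance $\mathcal{S}$. Let $\mathcal{T'}_0=\mathcal{T}$ and, for $t\ge 1$, let $\mathcal{T'}_t$ be the first-order subdivision of $\mathcal{T'}_{t-1}$. Then for every integer $t\ge 0$ the geodesic distance $\mathcal{S'}_t$ of $\mathcal{T'}_t$ satisfies $$\mathcal{S'}_{t}=8^{t}\mathcal{S}-\frac{1}{3}(2^{3t}-2^{t})(|\mathcal{V}|-1)+(2^{2t-1}-2^{3t-1})(|\mathcal{V}|-1)^{2}.$$
   Context: For a connected finite graph $G$, its geodesic distance is $\mathcal{S}(G)=\sum_{\{u,v\}} d_G(u,v)$, the sum of the shortest-path distances over all unordered pairs of distinct vertices of $G$. The first-order subdivision of a graph $G=(\mathcal{V},\mathcal{E})$ is the graph obtained by replacing every edge $uv\in\mathcal{E}$ by a path $uwv$ of length $2$, where $w$ is a new vertex, distinct for each edge. -}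

module Defs where

open import Data.Nat using (ℕ; zero; suc; _+_; _*_; _<ᵇ_)
open import Data.Bool using (Bool; true; false; _∨_; _∧_; if_then_else_)
open import Data.Fin using (Fin; toℕ; _↑ˡ_; _↑ʳ_; _≟_)
open import Data.List using (List; []; _∷_; length; lookup; map; allFin; concat; upTo)
open import Data.Bool.ListAction using (any)
open import Data.Nat.ListAction using (sum)
open import Data.List.Relation.Unary.Unique.Propositional using (Unique)
open import Data.Product using (_×_; _,_; proj₁; proj₂; ∃; ∃-syntax)
open import Relation.Binary.PropositionalEquality using (_≡_)
open import Relation.Nullary using (¬_)
open import Relation.Nullary.Decidable using (⌊_⌋)

-- A finite (multi)graph: vertex set Fin order, edges an explicit list of
-- unordered vertex pairs (each entry is one edge; indices distinguish edges).
record Graph : Set where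
  constructor mkGraph
  field
    order : ℕ
    edges : List (Fin order × Fin order)
open Graph public

Vertex : Graph → Set
Vertex G = Fin (order G)

EdgeIx : Graph → Set
EdgeIx G = Fin (length (edges G))

data Walk (G : Graph) : Vertex G → Vertex G → List (EdgeIx G) → Set where
  here : ∀ {u} → Walk G u u []
  fwd  : ∀ {v is} (i : EdgeIx G) →
         Walk G (proj₂ (lookup (edges G) i)) v is →
         Walk G (proj₁ (lookup (edges G) i)) v (i ∷ is)
  bwd  : ∀ {v is} (i : EdgeIx G) →
         Walk G (proj₁ (lookup (edges G) i)) v is →
         Walk G (proj₂ (lookup (edges G) i)) v (i ∷ is)

Connected : Graph → Set
Connected G = ∀ (u v : Vertex G) → ∃[ is ] Walk G u v is

-- A cycle: a nonempty closed walk using pairwise distinct edges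
-- (covers loops (length 1) and parallel edges (length 2)).
HasCycle : Graph → Set
HasCycle G = ∃[ u ] ∃[ i ] ∃[ is ] (Unique (i ∷ is) × Walk G u u (i ∷ is))

IsTree : Graph → Set
IsTree G = (0 Data.Nat.< order G) × Connected G × ¬ HasCycle G

reach : (G : Graph) → ℕ → Vertex G → Vertex G → Bool
reach G zero    u v = ⌊ u ≟ v ⌋
reach G (suc k) u v = reach G k u v ∨
  any (λ e → (⌊ proj₁ e ≟ u ⌋ ∧ reach G k (proj₂ e) v)
           ∨ (⌊ proj₂ e ≟ u ⌋ ∧ reach G k (proj₁ e) v)) (edges G)

firstReach : (G : Graph) → Vertex G → Vertex G → List ℕ → ℕ → ℕ
firstReach G u v []       d = d
firstReach G u v (k ∷ ks) d = if reach G k u v then k else firstReach G u v ks d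

-- shortest-path distance (a shortest walk in a connected graph on n
-- vertices has length < n, so searching k < order G suffices)
dist : (G : Graph) → Vertex G → Vertex G → ℕ
dist G u v = firstReach G u v (upTo (order G)) (order G)

geodesicDistance : Graph → ℕ
geodesicDistance G =
  sum (map (λ u → sum (map (λ v → if toℕ u <ᵇ toℕ v then dist G u v else 0)
                           (allFin (order G))))
           (allFin (order G)))

-- first-order subdivision: edge number i = (a , b) of G is replaced by the
-- path a — w_i — b, where w_i = order G + i is a new vertex.
subdivide : Graph → Graph
subdivide G = mkGraph (order G + m)
  (concat (map (λ i → let e = lookup (edges G) i
                          w = order G ↑ʳ i
                      in ((proj₁ e ↑ˡ m) , w) ∷ (w , (proj₂ e ↑ˡ m)) ∷ [])
               (allFin m)))
  where m = length (edges G)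

iterSubdivide : ℕ → Graph → Graph
iterSubdivide zero    G = G
iterSubdivide (suc t) G = subdivide (iterSubdivide t G)

module Submission where

-- Distances in a graph are characterised locally: d x x = 0, d x y ≤ 1 + d z y for neighbours x and z,
-- and a value d x y = 1 + j is always realised through a neighbour at distance j. This lets us write down
-- the distances of the subdivision and verify them: old vertices are twice as far apart as before, a
-- vertex u is at d(u,a) + d(u,b) from the midpoint of ab, and two midpoints are one step further apart
-- than the nearer end of one edge is from the midpoint of the other. In a tree, for every root y each
-- vertex other than y is the far end of exactly one edge; so sums over edges turn into sums over vertices,
-- ∑ₑ (d(a,y) + d(b,y)) + m = 2 ∑ᵥ d(v,y), and a counting argument shows that no edge but ab joins the two
-- sides of ab. Summing the explicit distances gives S(T') = 8 S(T) − 2m − 2m² for m = |V| − 1 edges; the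
-- subdivision inherits this structure, with 2m edges, and solving the recursion gives the formula.

open import Defs
open import Relation.Binary.PropositionalEquality using (_≡_; trans)

infixr 5 _∙_
_∙_ : ∀ {a} {A : Set a} {x y z : A} → x ≡ y → y ≡ z → x ≡ z
_∙_ = trans

module Sums where

  open import Data.Nat using (ℕ; zero; suc; _+_; _*_; _≤_; _<_; z≤n; s≤s; _<ᵇ_)
  open import Data.Nat.Properties
    using (+-*-semiring; *-distribˡ-+; +-cancelʳ-≡; +-assoc; +-identityʳ; *-identityʳ; *-zeroʳ; ≤-trans;
           m≤m+n; m≤n+m; +-mono-≤; ≤-antisym; ≮⇒≥; <-asym; <ᵇ⇒<; <⇒<ᵇ)
  open import Data.Fin using (Fin; zero; suc; toℕ; _≟_; _↑ˡ_; _↑ʳ_)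
  open import Data.Fin.Properties using (suc-injective; toℕ-injective)
  open import Data.List using (List; []; _∷_; length; lookup; map; allFin; concat; tabulate)
  open import Data.List.Properties using (map-tabulate; concat-map; map-∘)
  open import Data.Nat.ListAction using () renaming (sum to sumˡ)
  open import Data.Nat.ListAction.Properties using (sum-++)
  open import Data.Bool using (true; false; T; if_then_else_)
  open import Data.Unit using (tt)
  open import Data.Empty using (⊥-elim)
  open import Function using (_∘_)
  open import Relation.Binary.PropositionalEquality
  open import Relation.Nullary using (¬_; Dec; yes; no; ¬?)

  open import Algebra.Properties.Semiring.Sum +-*-semiring public
    using (sum-syntax; sum-cong-≗; ∑-distrib-+; ∑-comm; sum-replicate-zero; *-distribˡ-sum)

  𝟙 : ∀ {p} {P : Set p} → Dec P → ℕ
  𝟙 (yes _) = 1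
  𝟙 (no _) = 0

  module _ {p} {P : Set p} where

    𝟙-yes : (d : Dec P) → P → 𝟙 d ≡ 1
    𝟙-yes (yes _) _ = refl
    𝟙-yes (no ¬p) p = ⊥-elim (¬p p)

    𝟙-no : (d : Dec P) → ¬ P → 𝟙 d ≡ 0
    𝟙-no (yes p) ¬p = ⊥-elim (¬p p)
    𝟙-no (no _) _ = refl

    𝟙≤1 : (d : Dec P) → 𝟙 d ≤ 1
    𝟙≤1 (yes _) = s≤s z≤n
    𝟙≤1 (no _) = z≤n

    𝟙-sound : (d : Dec P) → 1 ≤ 𝟙 d → P
    𝟙-sound (yes p) _ = p

    𝟙-¬?+𝟙 : (d : Dec P) → 𝟙 (¬? d) + 𝟙 d ≡ 1
    𝟙-¬?+𝟙 (yes _) = refl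
    𝟙-¬?+𝟙 (no _) = refl

  sum-const : ∀ n c → ∑[ i < n ] c ≡ n * c
  sum-const zero c = refl
  sum-const (suc n) c = cong (c +_) (sum-const n c)

  ∑-↑ : ∀ n m (h : Fin (n + m) → ℕ) → ∑[ i < n + m ] h i ≡ ∑[ i < n ] h (i ↑ˡ m) + ∑[ j < m ] h (n ↑ʳ j)
  ∑-↑ zero m h = refl
  ∑-↑ (suc n) m h = trans (cong (h zero +_) (∑-↑ n m (h ∘ suc))) (sym (+-assoc (h zero) _ _))

  ≤-∑ : ∀ {n} (h : Fin n → ℕ) i → h i ≤ ∑[ j < n ] h j
  ≤-∑ h zero = m≤m+n (h zero) _
  ≤-∑ h (suc i) = ≤-trans (≤-∑ (h ∘ suc) i) (m≤n+m _ (h zero))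

  ∑-single : ∀ {n} (h : Fin n → ℕ) i → (∀ j → ¬ j ≡ i → h j ≡ 0) → ∑[ j < n ] h j ≡ h i
  ∑-single {suc n} h zero vanish =
    trans (cong (h zero +_) (trans (sum-cong-≗ (λ j → vanish (suc j) λ ())) (sum-replicate-zero n))) (+-identityʳ _)
  ∑-single {suc n} h (suc i) vanish =
    trans (cong (_+ ∑[ j < n ] h (suc j)) (vanish zero λ ()))
          (∑-single (h ∘ suc) i (λ j j≢i → vanish (suc j) (j≢i ∘ suc-injective)))

  ∑-𝟙-≟ : ∀ {n} (i : Fin n) x → ∑[ j < n ] (𝟙 (j ≟ i) * x) ≡ x
  ∑-𝟙-≟ i x = trans (∑-single _ i (λ j j≢i → cong (_* x) (𝟙-no (j ≟ i) j≢i)))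
                    (trans (cong (_* x) (𝟙-yes (i ≟ i) refl)) (+-identityʳ x))

  ∑≤1⇒unique : ∀ {n} (h : Fin n → ℕ) → ∑[ j < n ] h j ≤ 1 → ∀ {i j} → 1 ≤ h i → 1 ≤ h j → i ≡ j
  ∑≤1⇒unique h ≤1 {zero} {zero} _ _ = refl
  ∑≤1⇒unique h ≤1 {zero} {suc j} hi hj with ≤-trans (+-mono-≤ hi (≤-trans hj (≤-∑ (h ∘ suc) j))) ≤1
  ... | s≤s ()
  ∑≤1⇒unique h ≤1 {suc i} {zero} hi hj with ≤-trans (+-mono-≤ hj (≤-trans hi (≤-∑ (h ∘ suc) i))) ≤1
  ... | s≤s ()
  ∑≤1⇒unique h ≤1 {suc i} {suc j} hi hj =
    cong suc (∑≤1⇒unique (h ∘ suc) (≤-trans (m≤n+m _ (h zero)) ≤1) hi hj)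

  unique⇒∑≤1 : ∀ {n} (h : Fin n → ℕ) → (∀ i → h i ≤ 1) → (∀ {i j} → 1 ≤ h i → 1 ≤ h j → i ≡ j) →
               ∑[ j < n ] h j ≤ 1
  unique⇒∑≤1 {zero} h ≤1 unique = z≤n
  unique⇒∑≤1 {suc n} h ≤1 unique with h zero in eq
  ... | zero = unique⇒∑≤1 (h ∘ suc) (≤1 ∘ suc) (λ hi hj → suc-injective (unique hi hj))
  ... | suc k = subst (λ s → suc k + s ≤ 1) (sym tail≡0) (subst (_≤ 1) (trans eq (sym (+-identityʳ (suc k)))) (≤1 zero))
    where
    vanish : ∀ j → h (suc j) ≡ 0
    vanish j with h (suc j) in e
    ... | zero = refl
    ... | suc _ with unique {zero} {suc j} (subst (1 ≤_) (sym eq) (s≤s z≤n)) (subst (1 ≤_) (sym e) (s≤s z≤n))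
    ...   | ()
    tail≡0 : ∑[ j < n ] h (suc j) ≡ 0
    tail≡0 = trans (sum-cong-≗ vanish) (sum-replicate-zero n)

  ∑-reindex-except : ∀ {m n} (φ : Fin m → Fin n) (y : Fin n) →
    (∀ v → ∑[ i < m ] 𝟙 (φ i ≟ v) ≡ 𝟙 (¬? (v ≟ y))) →
    (h : Fin n → ℕ) → ∑[ i < m ] h (φ i) + h y ≡ ∑[ v < n ] h v
  ∑-reindex-except {m} {n} φ y fibre h = begin
    ∑[ i < m ] h (φ i) + h y
      ≡⟨ cong₂ _+_ (sum-cong-≗ expand) (sym (trans (∑-single (λ v → h v * 𝟙 (v ≟ y)) y vanish) atY)) ⟩
    ∑[ i < m ] ∑[ v < n ] (h v * 𝟙 (φ i ≟ v)) + ∑[ v < n ] (h v * 𝟙 (v ≟ y))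
      ≡⟨ cong (_+ _) (∑-comm (λ i v → h v * 𝟙 (φ i ≟ v))) ⟩
    ∑[ v < n ] ∑[ i < m ] (h v * 𝟙 (φ i ≟ v)) + ∑[ v < n ] (h v * 𝟙 (v ≟ y))
      ≡⟨ cong (_+ _) (sum-cong-≗ (λ v → trans (sym (*-distribˡ-sum (h v) (λ i → 𝟙 (φ i ≟ v)))) (cong (h v *_) (fibre v)))) ⟩
    ∑[ v < n ] (h v * 𝟙 (¬? (v ≟ y))) + ∑[ v < n ] (h v * 𝟙 (v ≟ y))
      ≡⟨ sym (∑-distrib-+ (λ v → h v * 𝟙 (¬? (v ≟ y))) (λ v → h v * 𝟙 (v ≟ y))) ⟩
    ∑[ v < n ] (h v * 𝟙 (¬? (v ≟ y)) + h v * 𝟙 (v ≟ y))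
      ≡⟨ sum-cong-≗ (λ v → trans (sym (*-distribˡ-+ (h v) _ _)) (trans (cong (h v *_) (𝟙-¬?+𝟙 (v ≟ y))) (*-identityʳ (h v)))) ⟩
    ∑[ v < n ] h v ∎
    where
    open ≡-Reasoning
    vanish : ∀ v → ¬ v ≡ y → h v * 𝟙 (v ≟ y) ≡ 0
    vanish v v≢y = trans (cong (h v *_) (𝟙-no (v ≟ y) v≢y)) (*-zeroʳ (h v))
    atY : h y * 𝟙 (y ≟ y) ≡ h y
    atY = trans (cong (h y *_) (𝟙-yes (y ≟ y) refl)) (*-identityʳ (h y))
    expand : ∀ i → h (φ i) ≡ ∑[ v < n ] (h v * 𝟙 (φ i ≟ v))
    expand i = sym (trans (∑-single (λ v → h v * 𝟙 (φ i ≟ v)) (φ i)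
                             (λ v v≢φi → trans (cong (h v *_) (𝟙-no (φ i ≟ v) (v≢φi ∘ sym))) (*-zeroʳ (h v))))
                          (trans (cong (h (φ i) *_) (𝟙-yes (φ i ≟ φ i) refl)) (*-identityʳ (h (φ i)))))

  ∑-lookup : ∀ {A : Set} (L : List A) (φ : A → ℕ) → ∑[ i < length L ] φ (lookup L i) ≡ sumˡ (map φ L)
  ∑-lookup [] φ = refl
  ∑-lookup (x ∷ L) φ = cong (φ x +_) (∑-lookup L φ)

  sumˡ-allFin : ∀ n (g : Fin n → ℕ) → sumˡ (map g (allFin n)) ≡ ∑[ i < n ] g i
  sumˡ-allFin n g = trans (cong sumˡ (map-tabulate (λ i → i) g)) (sumˡ-tabulate n g)
    where
    sumˡ-tabulate : ∀ n (g : Fin n → ℕ) → sumˡ (tabulate g) ≡ ∑[ i < n ] g i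
    sumˡ-tabulate zero g = refl
    sumˡ-tabulate (suc n) g = cong (g zero +_) (sumˡ-tabulate n (g ∘ suc))

  sumˡ-concat-allFin : ∀ {A : Set} m (es : Fin m → List A) (φ : A → ℕ) →
    sumˡ (map φ (concat (map es (allFin m)))) ≡ ∑[ i < m ] sumˡ (map φ (es i))
  sumˡ-concat-allFin m es φ = begin
    sumˡ (map φ (concat (map es (allFin m))))
      ≡⟨ cong sumˡ (sym (concat-map (map es (allFin m)))) ⟩
    sumˡ (concat (map (map φ) (map es (allFin m))))
      ≡⟨ sumˡ-concat (map (map φ) (map es (allFin m))) ⟩
    sumˡ (map sumˡ (map (map φ) (map es (allFin m))))
      ≡⟨ cong sumˡ (sym (trans (map-∘ {g = sumˡ} {f = map φ ∘ es} (allFin m))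
                               (cong (map sumˡ) (map-∘ {g = map φ} {f = es} (allFin m))))) ⟩
    sumˡ (map (λ i → sumˡ (map φ (es i))) (allFin m))
      ≡⟨ sumˡ-allFin m _ ⟩
    ∑[ i < m ] sumˡ (map φ (es i)) ∎
    where
    open ≡-Reasoning
    sumˡ-concat : (xss : List (List ℕ)) → sumˡ (concat xss) ≡ sumˡ (map sumˡ xss)
    sumˡ-concat [] = refl
    sumˡ-concat (xs ∷ xss) = trans (sum-++ xs (concat xss)) (cong (sumˡ xs +_) (sumˡ-concat xss))

  𝟙-≟-sym : ∀ {n} (x y : Fin n) → 𝟙 (x ≟ y) ≡ 𝟙 (y ≟ x)
  𝟙-≟-sym x y with x ≟ y | y ≟ x
  ... | yes _ | yes _ = refl
  ... | no _ | no _ = refl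
  ... | yes x≡y | no y≢x = ⊥-elim (y≢x (sym x≡y))
  ... | no x≢y | yes y≡x = ⊥-elim (x≢y (sym y≡x))

  𝟙-≟-injective : ∀ {a b} {X : Set a} {Y : Set b} (_≟X_ : (x x' : X) → Dec (x ≡ x')) (_≟Y_ : (y y' : Y) → Dec (y ≡ y'))
    (g : X → Y) → (∀ {x x'} → g x ≡ g x' → x ≡ x') → ∀ x x' → 𝟙 (g x ≟Y g x') ≡ 𝟙 (x ≟X x')
  𝟙-≟-injective _≟X_ _≟Y_ g g-inj x x' with g x ≟Y g x' | x ≟X x'
  ... | yes _ | yes _ = refl
  ... | no _ | no _ = refl
  ... | yes gx≡gx' | no x≢x' = ⊥-elim (x≢x' (g-inj gx≡gx'))
  ... | no gx≢gx' | yes refl = ⊥-elim (gx≢gx' refl)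

  𝟙-¬?-cong : ∀ {p q} {P : Set p} {Q : Set q} (d : Dec P) (d' : Dec Q) → 𝟙 d ≡ 𝟙 d' → 𝟙 (¬? d) ≡ 𝟙 (¬? d')
  𝟙-¬?-cong d d' eq = +-cancelʳ-≡ (𝟙 d) _ _ (trans (𝟙-¬?+𝟙 d) (sym (trans (cong (𝟙 (¬? d') +_) eq) (𝟙-¬?+𝟙 d'))))

  2*∑∑<≡∑∑ : ∀ n (g : Fin n → Fin n → ℕ) → (∀ u v → g u v ≡ g v u) → (∀ u → g u u ≡ 0) →
             2 * ∑[ u < n ] ∑[ v < n ] (if toℕ u <ᵇ toℕ v then g u v else 0) ≡ ∑[ u < n ] ∑[ v < n ] g u v
  2*∑∑<≡∑∑ n g g-sym g-diag = begin
    2 * ∑[ u < n ] ∑[ v < n ] upper u v                               ≡⟨ cong (∑∑upper +_) (+-identityʳ ∑∑upper) ⟩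
    ∑[ u < n ] ∑[ v < n ] upper u v + ∑[ u < n ] ∑[ v < n ] upper u v  ≡⟨ cong (∑∑upper +_) (∑-comm upper) ⟩
    ∑[ u < n ] ∑[ v < n ] upper u v + ∑[ u < n ] ∑[ v < n ] upper v u  ≡⟨ sym (∑-distrib-+ (λ u → ∑[ v < n ] upper u v) _) ⟩
    ∑[ u < n ] (∑[ v < n ] upper u v + ∑[ v < n ] upper v u)          ≡⟨ sum-cong-≗ (λ u → sym (∑-distrib-+ (upper u) _)) ⟩
    ∑[ u < n ] ∑[ v < n ] (upper u v + upper v u)                      ≡⟨ sum-cong-≗ (λ u → sum-cong-≗ (halves u)) ⟩
    ∑[ u < n ] ∑[ v < n ] g u v                                        ∎
    where
    open ≡-Reasoning
    upper : Fin n → Fin n → ℕ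
    upper u v = if toℕ u <ᵇ toℕ v then g u v else 0
    ∑∑upper : ℕ
    ∑∑upper = ∑[ u < n ] ∑[ v < n ] upper u v
    halves : ∀ u v → upper u v + upper v u ≡ g u v
    halves u v with toℕ u <ᵇ toℕ v in u<v | toℕ v <ᵇ toℕ u in v<u
    ... | true | true = ⊥-elim (<-asym (<ᵇ⇒< (toℕ u) (toℕ v) (subst T (sym u<v) tt)) (<ᵇ⇒< (toℕ v) (toℕ u) (subst T (sym v<u) tt)))
    ... | true | false = +-identityʳ _
    ... | false | true = sym (g-sym u v)
    ... | false | false = trans (sym (g-diag v)) (cong (λ w → g w v) (sym u≡v))
      where
      not< : ∀ {a b} → (a <ᵇ b) ≡ false → ¬ a < b
      not< eq a<b = subst T eq (<⇒<ᵇ a<b)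
      u≡v : u ≡ v
      u≡v = toℕ-injective (≤-antisym (≮⇒≥ (not< v<u)) (≮⇒≥ (not< u<v)))

module Arithmetic where

  open import Data.Nat using (ℕ; suc; _+_; _*_; _≤_; _⊓_; _<?_; ∣_-_∣)
  open import Data.Nat.Properties
    using (≤-trans; n≤1+n; n<1+n; <-asym; 0≢1+n; ≤-antisym; <-cmp; m≤n⇒m⊓n≡m; m≥n⇒m⊓n≡n; +-identityʳ)
  open import Data.Nat.Tactic.RingSolver using (solve-∀)
  open import Data.Sum using (_⊎_; inj₁; inj₂)
  open import Relation.Binary.Definitions using (tri<; tri≈; tri>)
  open import Relation.Binary.PropositionalEquality
  open import Relation.Nullary using (¬_; Dec; yes; no; contradiction)

  open Sums using (𝟙; 𝟙-yes; 𝟙-no)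

  OneApart : ℕ → ℕ → Set
  OneApart a b = a ≡ suc b ⊎ b ≡ suc a

  TwoApart : ℕ → ℕ → Set
  TwoApart a b = a ≡ 2 + b ⊎ b ≡ 2 + a

  oneApart-sym : ∀ {a b} → OneApart a b → OneApart b a
  oneApart-sym (inj₁ e) = inj₂ e
  oneApart-sym (inj₂ e) = inj₁ e

  ≢∧≤1+∧≥1+⇒oneApart : ∀ {a b} → ¬ a ≡ b → a ≤ suc b → b ≤ suc a → OneApart a b
  ≢∧≤1+∧≥1+⇒oneApart {a} {b} a≢b a≤1+b b≤1+a with <-cmp a b
  ... | tri< a<b _ _ = inj₂ (≤-antisym b≤1+a a<b)
  ... | tri≈ _ a≡b _ = contradiction a≡b a≢b
  ... | tri> _ _ b<a = inj₁ (≤-antisym a≤1+b b<a)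

  oneApart⇒+≡1+2*⊓ : ∀ {a b} → OneApart a b → a + b ≡ suc (2 * (a ⊓ b))
  oneApart⇒+≡1+2*⊓ {_} {b} (inj₁ refl) rewrite m≥n⇒m⊓n≡n (n≤1+n b) = lemma b
    where lemma : ∀ b → suc b + b ≡ suc (2 * b)
          lemma = solve-∀
  oneApart⇒+≡1+2*⊓ {a} (inj₂ refl) rewrite m≤n⇒m⊓n≡m (n≤1+n a) = lemma a
    where lemma : ∀ a → a + suc a ≡ suc (2 * a)
          lemma = solve-∀

  oneApart⇒twoApart-odd : ∀ {a b} → OneApart a b → TwoApart (suc (2 * a)) (suc (2 * b))
  oneApart⇒twoApart-odd {_} {b} (inj₁ refl) = inj₁ (lemma b)
    where lemma : ∀ b → suc (2 * suc b) ≡ 2 + suc (2 * b)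
          lemma = solve-∀
  oneApart⇒twoApart-odd {a} (inj₂ refl) = inj₂ (lemma a)
    where lemma : ∀ a → suc (2 * suc a) ≡ 2 + suc (2 * a)
          lemma = solve-∀

  twoApart⇒2*1+⊓≡+ : ∀ {a b} → TwoApart a b → 2 * suc (a ⊓ b) ≡ a + b
  twoApart⇒2*1+⊓≡+ {_} {b} (inj₁ refl) rewrite m≥n⇒m⊓n≡n (≤-trans (n≤1+n b) (n≤1+n (suc b))) = lemma b
    where lemma : ∀ b → 2 * suc b ≡ 2 + b + b
          lemma = solve-∀
  twoApart⇒2*1+⊓≡+ {a} (inj₂ refl) rewrite m≤n⇒m⊓n≡m (≤-trans (n≤1+n a) (n≤1+n (suc a))) = lemma a
    where lemma : ∀ a → 2 * suc a ≡ a + (2 + a)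
          lemma = solve-∀

  less : ℕ → ℕ → ℕ
  less a b = 𝟙 (a <? b)

  less≡0⊎less≡1 : ∀ a b → less a b ≡ 0 ⊎ less a b ≡ 1
  less≡0⊎less≡1 a b with a <? b
  ... | yes _ = inj₂ refl
  ... | no _ = inj₁ refl

  less-suc : ∀ a → less a (suc a) ≡ 1
  less-suc a = 𝟙-yes (a <? suc a) (n<1+n a)

  less-pred : ∀ a → less (suc a) a ≡ 0
  less-pred a = 𝟙-no (suc a <? a) (<-asym (n<1+n a))

  oneApart-less₁ : ∀ {a b} → less a b ≡ 1 → OneApart a b → b ≡ suc a
  oneApart-less₁ _ (inj₂ b≡1+a) = b≡1+a
  oneApart-less₁ {b = b} less≡1 (inj₁ refl) = contradiction (trans (sym (less-pred b)) less≡1) 0≢1+n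

  oneApart-less₀ : ∀ {a b} → less a b ≡ 0 → OneApart a b → a ≡ suc b
  oneApart-less₀ _ (inj₁ a≡1+b) = a≡1+b
  oneApart-less₀ {a} less≡0 (inj₂ refl) = contradiction (trans (sym less≡0) (less-suc a)) 0≢1+n

  choose : ∀ {p} {P : Set p} → Dec P → ℕ → ℕ → ℕ
  choose (yes _) a b = b
  choose (no _) a b = a

  choose-same : ∀ {p} {P : Set p} (d : Dec P) x → choose d x x ≡ x
  choose-same (yes _) x = refl
  choose-same (no _) x = refl

  choose-yes : ∀ {p} {P : Set p} (d : Dec P) → P → ∀ x y → choose d x y ≡ y
  choose-yes (yes _) _ x y = refl
  choose-yes (no ¬p) p x y = contradiction p ¬p

  choose-no : ∀ {p} {P : Set p} (d : Dec P) → ¬ P → ∀ x y → choose d x y ≡ x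
  choose-no (yes p) ¬p x y = contradiction p ¬p
  choose-no (no _) _ x y = refl

  -- Read αa, αb (βa, βb) as the distances of the ends of an edge ab to c (to c'), for another edge cc'; then
  -- less αa βa is the side of cc' on which a lies, and moving the root from c to c' moves the far end of ab
  -- to the other side exactly when ab crosses.
  choose-less-crossing : ∀ αa αb βa βb → OneApart αa αb → OneApart βa βb → OneApart αa βa → OneApart αb βb →
    choose (αa <? αb) (less αa βa) (less αb βb) + ∣ less αa βa - less αb βb ∣
      ≡ choose (βa <? βb) (less αa βa) (less αb βb)
  choose-less-crossing αa αb _ _ _ _ (inj₂ refl) (inj₂ refl) rewrite less-suc αa | less-suc αb =
    trans (cong (_+ 0) (choose-same (αa <? αb) 1)) (sym (choose-same (suc αa <? suc αb) 1))
  choose-less-crossing _ _ βa βb _ _ (inj₁ refl) (inj₁ refl) rewrite less-pred βa | less-pred βb =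
    trans (+-identityʳ _) (trans (choose-same (suc βa <? suc βb) 0) (sym (choose-same (βa <? βb) 0)))
  choose-less-crossing αa _ _ _ (inj₂ refl) _ (inj₂ refl) (inj₁ refl) rewrite less-suc αa | less-pred αa =
    trans (cong (_+ 1) (choose-yes (αa <? suc αa) (n<1+n αa) 1 0)) (sym (choose-no (suc αa <? αa) (<-asym (n<1+n αa)) 1 0))
  choose-less-crossing _ _ _ _ (inj₁ refl) (inj₁ ()) (inj₂ refl) (inj₁ refl)
  choose-less-crossing _ _ _ _ (inj₁ refl) (inj₂ ()) (inj₂ refl) (inj₁ refl)
  choose-less-crossing _ _ βa _ (inj₁ refl) _ (inj₁ refl) (inj₂ refl) rewrite less-suc βa | less-pred βa =
    trans (cong (_+ 1) (choose-no (suc βa <? βa) (<-asym (n<1+n βa)) 0 1)) (sym (choose-yes (βa <? suc βa) (n<1+n βa) 0 1))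
  choose-less-crossing _ _ _ _ (inj₂ refl) (inj₁ ()) (inj₁ refl) (inj₂ refl)
  choose-less-crossing _ _ _ _ (inj₂ refl) (inj₂ ()) (inj₁ refl) (inj₂ refl)

module Distance where

  open import Data.Nat using (ℕ; zero; suc; _+_; _≤_; _<_; s≤s; _∸_; _≤?_; _<?_)
  open import Data.Nat.Properties
    using (≤-refl; ≤-trans; ≤-reflexive; ≤∧≢⇒<; 1+n≰n; ≤-antisym; ≤-pred; <-irrefl; <-cmp; ≮⇒≥; ≰⇒>; m≤n⇒m≤1+n;
           +-identityʳ; +-suc; +-comm; +-monoˡ-≤; +-monoʳ-≤; m∸n+n≡m; n≤0⇒n≡0)
  open import Data.Bool using (Bool; true; false; T; _∧_; _∨_)
  open import Data.Bool.Properties using (T-∨; T-∧)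
  open import Data.Fin using (Fin; toℕ; _≟_)
  open import Data.Fin.Properties using (pigeonhole; toℕ<n)
  open import Data.List using (_∷_; length; applyUpTo; upTo)
  open import Data.List.Relation.Unary.Any using (Any; here; there)
  open import Data.List.Relation.Unary.Any.Properties using (any⁺; any⁻)
  open import Data.List.Membership.Propositional using (lose)
  open import Data.List.Membership.Propositional.Properties using (∈-lookup)
  open import Data.Product using (_×_; _,_; proj₁; proj₂; ∃-syntax; ∃₂)
  open import Data.Sum using (_⊎_; inj₁; inj₂)
  open import Data.Empty using (⊥-elim)
  open import Data.Unit using (tt)
  open import Function using (_∘_; Equivalence)
  open import Relation.Binary.Definitions using (tri<; tri≈; tri>)
  open import Relation.Binary.PropositionalEquality
  open import Relation.Nullary using (¬_; yes; no; contradiction)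
  open import Relation.Nullary.Decidable using (⌊_⌋; toWitness; fromWitness)

  open Equivalence using (to; from)

  Joins : ∀ {n} → Fin n → Fin n → Fin n × Fin n → Set
  Joins x z e = (proj₁ e ≡ x × proj₂ e ≡ z) ⊎ (proj₂ e ≡ x × proj₁ e ≡ z)

  joins-sym : ∀ {n} {x z : Fin n} {e} → Joins x z e → Joins z x e
  joins-sym (inj₁ (p , q)) = inj₂ (q , p)
  joins-sym (inj₂ (p , q)) = inj₁ (q , p)

  Adjacent : (G : Graph) → Vertex G → Vertex G → Set
  Adjacent G x z = Any (Joins x z) (edges G)

  adjacent-sym : ∀ {G} {x z : Vertex G} → Adjacent G x z → Adjacent G z x
  adjacent-sym (here j) = here (joins-sym j)
  adjacent-sym (there a) = there (adjacent-sym a)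

  module _ (G : Graph) where

    private
      via : ℕ → Vertex G → Vertex G → Vertex G → Vertex G → Bool
      via k x y a b = ⌊ a ≟ x ⌋ ∧ reach G k b y

      step? : ℕ → Vertex G → Vertex G → Vertex G × Vertex G → Bool
      step? k x y e = via k x y (proj₁ e) (proj₂ e) ∨ via k x y (proj₂ e) (proj₁ e)

      via⁻ : ∀ k x y a b → T (via k x y a b) → a ≡ x × T (reach G k b y)
      via⁻ k x y a b h = toWitness (proj₁ (to (T-∧ {⌊ a ≟ x ⌋}) h)) , proj₂ (to (T-∧ {⌊ a ≟ x ⌋}) h)

      via⁺ : ∀ k x y a b → a ≡ x → T (reach G k b y) → T (via k x y a b)
      via⁺ k x y a b a≡x r = from (T-∧ {⌊ a ≟ x ⌋}) (fromWitness a≡x , r)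

      step?⁻ : ∀ k x y e → T (step? k x y e) → ∃[ z ] (Joins x z e × T (reach G k z y))
      step?⁻ k x y (a , b) h with to (T-∨ {via k x y a b}) h
      ... | inj₁ h₁ = b , inj₁ (proj₁ (via⁻ k x y a b h₁) , refl) , proj₂ (via⁻ k x y a b h₁)
      ... | inj₂ h₂ = a , inj₂ (proj₁ (via⁻ k x y b a h₂) , refl) , proj₂ (via⁻ k x y b a h₂)

      step?⁺ : ∀ k x y z e → Joins x z e → T (reach G k z y) → T (step? k x y e)
      step?⁺ k x y z (a , b) (inj₁ (a≡x , refl)) r = from (T-∨ {via k x y a b}) (inj₁ (via⁺ k x y a b a≡x r))
      step?⁺ k x y z (a , b) (inj₂ (b≡x , refl)) r = from (T-∨ {via k x y a b}) (inj₂ (via⁺ k x y b a b≡x r))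

      any-step?⁻ : ∀ k x y {es} → Any (T ∘ step? k x y) es → ∃[ z ] (Any (Joins x z) es × T (reach G k z y))
      any-step?⁻ k x y (here p) with step?⁻ k x y _ p
      ... | z , j , r = z , here j , r
      any-step?⁻ k x y (there a) with any-step?⁻ k x y a
      ... | z , j , r = z , there j , r

      any-step?⁺ : ∀ k x y z {es} → Any (Joins x z) es → T (reach G k z y) → Any (T ∘ step? k x y) es
      any-step?⁺ k x y z (here j) r = here (step?⁺ k x y z _ j r)
      any-step?⁺ k x y z (there a) r = there (any-step?⁺ k x y z a r)

    reach-suc⁻ : ∀ k x y → T (reach G (suc k) x y) →
                 T (reach G k x y) ⊎ ∃[ z ] (Adjacent G x z × T (reach G k z y))
    reach-suc⁻ k x y h with to (T-∨ {reach G k x y}) h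
    ... | inj₁ r = inj₁ r
    ... | inj₂ a = inj₂ (any-step?⁻ k x y (any⁻ (step? k x y) (edges G) a))

    reach-suc⁺ : ∀ k x y → T (reach G k x y) ⊎ ∃[ z ] (Adjacent G x z × T (reach G k z y)) →
                 T (reach G (suc k) x y)
    reach-suc⁺ k x y (inj₁ r) = from (T-∨ {reach G k x y}) (inj₁ r)
    reach-suc⁺ k x y (inj₂ (z , adj , r)) = from (T-∨ {reach G k x y}) (inj₂ (any⁺ (step? k x y) (any-step?⁺ k x y z adj r)))

    reach-mono : ∀ {k k'} x y → k ≤ k' → T (reach G k x y) → T (reach G k' x y)
    reach-mono {k} {k'} x y k≤k' r = subst (λ j → T (reach G j x y)) (m∸n+n≡m k≤k') (go (k' ∸ k) r)
      where
      go : ∀ i → T (reach G k x y) → T (reach G (i + k) x y)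
      go zero r = r
      go (suc i) r = reach-suc⁺ (i + k) x y (inj₁ (go i r))

    walk⇒reach : ∀ {x y is} → Walk G x y is → T (reach G (length is) x y)
    walk⇒reach {x} here = fromWitness {a? = x ≟ x} refl
    walk⇒reach {is = i ∷ is} (fwd i w) =
      reach-suc⁺ (length is) _ _ (inj₂ (_ , lose (∈-lookup i) (inj₁ (refl , refl)) , walk⇒reach w))
    walk⇒reach {is = i ∷ is} (bwd i w) =
      reach-suc⁺ (length is) _ _ (inj₂ (_ , lose (∈-lookup i) (inj₂ (refl , refl)) , walk⇒reach w))

    Least : Vertex G → Vertex G → ℕ → Set
    Least x y r = T (reach G r x y) × (∀ {j} → j < r → ¬ T (reach G j x y))

    least-unique : ∀ {x y r r'} → Least x y r → Least x y r' → r ≡ r'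
    least-unique {r = r} {r'} (reach-r , below-r) (reach-r' , below-r') with <-cmp r r'
    ... | tri< r<r' _ _ = contradiction reach-r (below-r' r<r')
    ... | tri≈ _ r≡r' _ = r≡r'
    ... | tri> _ _ r'<r = contradiction reach-r' (below-r r'<r)

    firstReach-least : ∀ {x y K} c → T (reach G K x y) → K < c → ∀ d → Least x y (firstReach G x y (upTo c) d)
    firstReach-least {x} {y} {K} c reach-K K<c d =
      go c (λ j → j) 0 (λ j → refl) (λ ()) K<c
      where
      go : ∀ c (g : ℕ → ℕ) s → (∀ j → g j ≡ s + j) → (∀ {j} → j < s → ¬ T (reach G j x y)) → K < s + c →
           Least x y (firstReach G x y (applyUpTo g c) d)
      go zero g s g≡ below K<s = contradiction reach-K (below (subst (K <_) (+-identityʳ s) K<s))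
      go (suc c) g s g≡ below K<s with reach G (g 0) x y in eq
      ... | true = subst T (sym eq) tt , λ j<g0 → below (subst (_ <_) (trans (g≡ 0) (+-identityʳ s)) j<g0)
      ... | false = go c (g ∘ suc) (suc s) (λ j → trans (g≡ (suc j)) (+-suc s j)) below' (subst (K <_) (+-suc s c) K<s)
        where
        below' : ∀ {j} → j < suc s → ¬ T (reach G j x y)
        below' {j} j<1+s with j <? s
        ... | yes j<s = below j<s
        ... | no j≮s = subst T (trans (cong (λ k → reach G k x y) j≡g0) eq)
          where
          j≡g0 : j ≡ g 0
          j≡g0 = trans (≤-antisym (≤-pred j<1+s) (≮⇒≥ j≮s)) (sym (trans (g≡ 0) (+-identityʳ s)))

  record IsDistance (G : Graph) (d : Vertex G → Vertex G → ℕ) : Set where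
    field
      d-self : ∀ x → d x x ≡ 0
      d≡0⇒≡ : ∀ x y → d x y ≡ 0 → x ≡ y
      d-neighbour : ∀ x z y → Adjacent G x z → d x y ≤ suc (d z y)
      d-descend : ∀ x y j → d x y ≡ suc j → ∃[ z ] (Adjacent G x z × d z y ≡ j)

  least⇒isDistance : ∀ {G} (r : Vertex G → Vertex G → ℕ) → (∀ x y → Least G x y (r x y)) → IsDistance G r
  least⇒isDistance {G} r least = record
    { d-self = λ x → n≤0⇒n≡0 (reach⇒≥ 0 x x (fromWitness {a? = x ≟ x} refl))
    ; d≡0⇒≡ = λ x y r≡0 → toWitness (≤⇒reach 0 x y (≤-reflexive r≡0))
    ; d-neighbour = neighbour
    ; d-descend = descend
    }
    where
    reach⇒≥ : ∀ k x y → T (reach G k x y) → r x y ≤ k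
    reach⇒≥ k x y reach-k with r x y ≤? k
    ... | yes r≤k = r≤k
    ... | no r≰k = contradiction reach-k (proj₂ (least x y) (≰⇒> r≰k))
    ≤⇒reach : ∀ k x y → r x y ≤ k → T (reach G k x y)
    ≤⇒reach k x y r≤k = reach-mono G x y r≤k (proj₁ (least x y))
    neighbour : ∀ x z y → Adjacent G x z → r x y ≤ suc (r z y)
    neighbour x z y adj = reach⇒≥ (suc (r z y)) x y (reach-suc⁺ G (r z y) x y (inj₂ (z , adj , proj₁ (least z y))))
    descend : ∀ x y j → r x y ≡ suc j → ∃[ z ] (Adjacent G x z × r z y ≡ j)
    descend x y j r≡1+j with reach-suc⁻ G j x y (≤⇒reach (suc j) x y (≤-reflexive r≡1+j))
    ... | inj₁ reach-j = contradiction (≤-trans (≤-reflexive (sym r≡1+j)) (reach⇒≥ j x y reach-j)) 1+n≰n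
    ... | inj₂ (z , adj , reach-j) =
      z , adj , ≤-antisym (reach⇒≥ j z y reach-j) (≤-pred (≤-trans (≤-reflexive (sym r≡1+j)) (neighbour x z y adj)))

  connected⇒distance : ∀ {G} → Connected G → ∃[ d ] IsDistance G d
  connected⇒distance {G} conn = r , least⇒isDistance r least
    where
    walkLength : Vertex G → Vertex G → ℕ
    walkLength x y = length (proj₁ (conn x y))
    r : Vertex G → Vertex G → ℕ
    r x y = firstReach G x y (upTo (suc (walkLength x y))) 0
    least : ∀ x y → Least G x y (r x y)
    least x y = firstReach-least G (suc (walkLength x y)) (walk⇒reach G (proj₂ (conn x y))) ≤-refl 0

  module DistanceProperties {G : Graph} {d : Vertex G → Vertex G → ℕ} (isDistance : IsDistance G d) where
    open IsDistance isDistance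

    reach⇒≤ : ∀ k x y → T (reach G k x y) → d x y ≤ k
    reach⇒≤ zero x y r rewrite toWitness {a? = x ≟ y} r = ≤-reflexive (d-self y)
    reach⇒≤ (suc k) x y r with reach-suc⁻ G k x y r
    ... | inj₁ r' = m≤n⇒m≤1+n (reach⇒≤ k x y r')
    ... | inj₂ (z , adj , r') = ≤-trans (d-neighbour x z y adj) (s≤s (reach⇒≤ k z y r'))

    ≤⇒reach : ∀ k x y → d x y ≤ k → T (reach G k x y)
    ≤⇒reach zero x y d≤0 = fromWitness {a? = x ≟ y} (d≡0⇒≡ x y (n≤0⇒n≡0 d≤0))
    ≤⇒reach (suc k) x y d≤1+k with d x y ≤? k
    ... | yes d≤k = reach-suc⁺ G k x y (inj₁ (≤⇒reach k x y d≤k))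
    ... | no d≰k with d-descend x y k (≤-antisym d≤1+k (≰⇒> d≰k))
    ...   | z , adj , d≡k = reach-suc⁺ G k x y (inj₂ (z , adj , ≤⇒reach k z y (≤-reflexive d≡k)))

    distance-least : ∀ x y → Least G x y (d x y)
    distance-least x y = ≤⇒reach (d x y) x y ≤-refl , λ j<d r → <-irrefl refl (≤-trans j<d (reach⇒≤ _ x y r))

    d-triangle : ∀ x z y → d x y ≤ d x z + d z y
    d-triangle x z y = go (d x z) x refl
      where
      go : ∀ k x → d x z ≡ k → d x y ≤ k + d z y
      go zero x d≡0 rewrite d≡0⇒≡ x z d≡0 = ≤-refl
      go (suc k) x d≡1+k with d-descend x z k d≡1+k
      ... | w , adj , d≡k = ≤-trans (d-neighbour x w y adj) (s≤s (go k w d≡k))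

    d-sym : ∀ x y → d x y ≡ d y x
    d-sym x y = ≤-antisym (d-sym-≤ y x) (d-sym-≤ x y)
      where
      d-sym-≤ : ∀ x y → d y x ≤ d x y
      d-sym-≤ x y = go (d x y) x refl
        where
        go : ∀ k x → d x y ≡ k → d y x ≤ k
        go zero x d≡0 rewrite d≡0⇒≡ x y d≡0 = ≤-reflexive (d-self y)
        go (suc k) x d≡1+k with d-descend x y k d≡1+k
        ... | w , adj , d≡k = ≤-trans (d-triangle y w x)
                (≤-trans (+-monoˡ-≤ (d w x) (go k w d≡k))
                  (≤-trans (+-monoʳ-≤ k (≤-trans (d-neighbour w x x (adjacent-sym adj)) (s≤s (≤-reflexive (d-self x)))))
                    (≤-reflexive (+-comm k 1))))

    d-intermediate : ∀ x y i → i ≤ d x y → ∃[ v ] d v y ≡ i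
    d-intermediate x y i = go (d x y) x refl
      where
      go : ∀ j x → d x y ≡ j → i ≤ j → ∃[ v ] d v y ≡ i
      go j x d≡j i≤j with i Data.Nat.≟ j
      ... | yes refl = x , d≡j
      go zero x d≡j i≤j | no i≢j = ⊥-elim (i≢j (n≤0⇒n≡0 i≤j))
      go (suc j) x d≡j i≤j | no i≢j with d-descend x y j d≡j
      ... | z , _ , d≡j' = go j z d≡j' (≤-pred (≤∧≢⇒< i≤j i≢j))

    -- The values 0, 1, …, d x y are attained at distinct vertices.
    d<order : ∀ x y → d x y < order G
    d<order x y with d x y <? order G
    ... | yes d<n = d<n
    ... | no d≮n = ⊥-elim (noRepeat (pigeonhole (s≤s (≮⇒≥ d≮n)) (proj₁ ∘ vertexAt)))
      where
      vertexAt : (i : Fin (suc (d x y))) → ∃[ v ] d v y ≡ toℕ i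
      vertexAt i = d-intermediate x y (toℕ i) (≤-pred (toℕ<n i))
      noRepeat : ¬ ∃₂ λ i j → i Data.Fin.< j × proj₁ (vertexAt i) ≡ proj₁ (vertexAt j)
      noRepeat (i , j , i<j , same) =
        <-irrefl (trans (sym (proj₂ (vertexAt i))) (trans (cong (λ v → d v y) same) (proj₂ (vertexAt j)))) i<j

    dist≡d : ∀ x y → dist G x y ≡ d x y
    dist≡d x y = least-unique G (firstReach-least G (order G) (proj₁ (distance-least x y)) (d<order x y) (order G))
                                (distance-least x y)

module TreeDistances where

  open import Data.Nat using (ℕ; zero; suc; _+_; _*_; _≤_; _<_; z≤n; s≤s; _<?_; ∣_-_∣)
  open import Data.Nat.Properties
    using (≤-reflexive; ≤-pred; <-asym; ≮⇒≥; ≤∧≢⇒<; *-monoʳ-<; *-cancelˡ-<; *-identityʳ;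
           +-identityʳ; +-cancelˡ-≡; 0≢1+n; ∣m-n∣≡0⇒m≡n)
  open import Data.Nat.Tactic.RingSolver using (solve-∀)
  open import Data.Fin using (Fin; _≟_)
  open import Data.List using (List; length; lookup)
  open import Data.List.Membership.Propositional using (_∈_; lose)
  open import Data.List.Membership.Propositional.Properties using (∈-lookup)
  open import Data.Product using (_×_; _,_; proj₁; proj₂; ∃-syntax)
  open import Data.Sum using (_⊎_; inj₁; inj₂)
  open import Relation.Binary.PropositionalEquality
  open import Relation.Nullary using (¬_; yes; no; ¬?; contradiction)

  open Sums
  open Distance
  open Arithmetic

  farEnd : ∀ {n} {R : Set} → (Fin n → R → ℕ) → R → Fin n × Fin n → Fin n
  farEnd d y e with d (proj₁ e) y <? d (proj₂ e) y
  ... | yes _ = proj₂ e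
  ... | no _ = proj₁ e

  module _ {n} {R : Set} (d : Fin n → R → ℕ) (y : R) where

    farEnd-closer : ∀ e → ¬ d (proj₁ e) y ≡ d (proj₂ e) y → ∃[ p ] (Joins (farEnd d y e) p e × d p y < d (farEnd d y e) y)
    farEnd-closer e ends≢ with d (proj₁ e) y <? d (proj₂ e) y
    ... | yes <₁₂ = proj₁ e , inj₂ (refl , refl) , <₁₂
    ... | no ≮₁₂ = proj₂ e , inj₁ (refl , refl) , ≤∧≢⇒< (≮⇒≥ ≮₁₂) (λ e → ends≢ (sym e))

    farEnd-≡ : ∀ e {v p} → Joins v p e → d p y < d v y → farEnd d y e ≡ v
    farEnd-≡ e (inj₁ (refl , refl)) p<v with d (proj₁ e) y <? d (proj₂ e) y
    ... | yes v<p = contradiction v<p (<-asym p<v)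
    ... | no _ = refl
    farEnd-≡ e (inj₂ (refl , refl)) p<v with d (proj₁ e) y <? d (proj₂ e) y
    ... | yes _ = refl
    ... | no p≮v = contradiction p<v p≮v

    farEnd-end : ∀ e → farEnd d y e ≡ proj₁ e ⊎ farEnd d y e ≡ proj₂ e
    farEnd-end e with d (proj₁ e) y <? d (proj₂ e) y
    ... | yes _ = inj₂ refl
    ... | no _ = inj₁ refl

  farEnd-1+2* : ∀ {n} {R R' : Set} (d : Fin n → R → ℕ) (d' : Fin n → R' → ℕ) y y' e →
                d' (proj₁ e) y' ≡ suc (2 * d (proj₁ e) y) → d' (proj₂ e) y' ≡ suc (2 * d (proj₂ e) y) →
                farEnd d' y' e ≡ farEnd d y e
  farEnd-1+2* d d' y y' e d'₁ d'₂ with d (proj₁ e) y <? d (proj₂ e) y | d' (proj₁ e) y' <? d' (proj₂ e) y'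
  ... | yes _ | yes _ = refl
  ... | no _ | no _ = refl
  ... | yes <₁₂ | no ≮'₁₂ = contradiction (subst₂ _<_ (sym d'₁) (sym d'₂) (s≤s (*-monoʳ-< 2 <₁₂))) ≮'₁₂
  ... | no ≮₁₂ | yes <'₁₂ = contradiction (*-cancelˡ-< 2 _ _ (≤-pred (subst₂ _<_ d'₁ d'₂ <'₁₂))) ≮₁₂

  parentCount : (G : Graph) → (Vertex G → Vertex G → ℕ) → Vertex G → Vertex G → ℕ
  parentCount G d y v = ∑[ i < length (edges G) ] 𝟙 (farEnd d y (lookup (edges G) i) ≟ v)

  -- parentCount≡ says that for every root y the edges, oriented away from y, form a tree of shortest paths to y.
  record TreeDistance (G : Graph) : Set where
    field
      d : Vertex G → Vertex G → ℕ
      isDistance : IsDistance G d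
      ends-differ : ∀ {e} → e ∈ edges G → ∀ y → ¬ d (proj₁ e) y ≡ d (proj₂ e) y
      parentCount≡ : ∀ y v → parentCount G d y v ≡ 𝟙 (¬? (v ≟ y))

  module TreeDistanceProperties {G : Graph} (τ : TreeDistance G) where
    open TreeDistance τ public
    open IsDistance isDistance public
    open DistanceProperties isDistance public

    E : List (Vertex G × Vertex G)
    E = edges G

    m n : ℕ
    m = length E
    n = order G

    A B : Fin m → Vertex G
    A i = proj₁ (lookup E i)
    B i = proj₂ (lookup E i)

    edge-adjacent : ∀ i → Adjacent G (A i) (B i)
    edge-adjacent i = lose (∈-lookup i) (inj₁ (refl , refl))

    ends-oneApart : ∀ i y → OneApart (d (A i) y) (d (B i) y)
    ends-oneApart i y = ≢∧≤1+∧≥1+⇒oneApart (ends-differ (∈-lookup i) y)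
      (d-neighbour (A i) (B i) y (edge-adjacent i)) (d-neighbour (B i) (A i) y (adjacent-sym (edge-adjacent i)))

    child : Fin m → Vertex G → Vertex G
    child i y = farEnd d y (lookup E i)

    ends+1≡2*child : ∀ i y → d (A i) y + d (B i) y + 1 ≡ 2 * d (child i y) y
    ends+1≡2*child i y with ends-oneApart i y
    ... | inj₁ A≡1+B rewrite farEnd-≡ d y (lookup E i) {A i} {B i} (inj₁ (refl , refl)) (≤-reflexive (sym A≡1+B)) | A≡1+B =
      lemma (d (B i) y)
      where lemma : ∀ x → suc x + x + 1 ≡ 2 * suc x
            lemma = solve-∀
    ... | inj₂ B≡1+A rewrite farEnd-≡ d y (lookup E i) {B i} {A i} (inj₂ (refl , refl)) (≤-reflexive (sym B≡1+A)) | B≡1+A =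
      lemma (d (A i) y)
      where lemma : ∀ x → x + suc x + 1 ≡ 2 * suc x
            lemma = solve-∀

    ∑-children : ∀ y (h : Vertex G → ℕ) → ∑[ i < m ] h (child i y) + h y ≡ ∑[ v < n ] h v
    ∑-children y = ∑-reindex-except (λ i → child i y) y (parentCount≡ y)

    totalDistance : Vertex G → ℕ
    totalDistance y = ∑[ v < n ] d v y

    ∑-ends : ∀ y → ∑[ i < m ] (d (A i) y + d (B i) y) + m ≡ 2 * totalDistance y
    ∑-ends y = begin
      ∑[ i < m ] (d (A i) y + d (B i) y) + m
        ≡⟨ cong (∑[ i < m ] (d (A i) y + d (B i) y) +_) (sym (trans (sum-const m 1) (*-identityʳ m))) ⟩
      ∑[ i < m ] (d (A i) y + d (B i) y) + ∑[ i < m ] 1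
        ≡⟨ sym (∑-distrib-+ (λ i → d (A i) y + d (B i) y) (λ _ → 1)) ⟩
      ∑[ i < m ] (d (A i) y + d (B i) y + 1)
        ≡⟨ sum-cong-≗ (λ i → ends+1≡2*child i y) ⟩
      ∑[ i < m ] (2 * d (child i y) y)
        ≡⟨ sym (*-distribˡ-sum 2 (λ i → d (child i y) y)) ⟩
      2 * ∑[ i < m ] d (child i y) y
        ≡⟨ cong (2 *_) (trans (sym (+-identityʳ _)) (trans (cong (∑[ i < m ] d (child i y) y +_) (sym (d-self y)))
                                                     (∑-children y (λ v → d v y)))) ⟩
      2 * totalDistance y ∎
      where open ≡-Reasoning

    order≡size+1 : Vertex G → n ≡ m + 1
    order≡size+1 y = sym (trans (cong (_+ 1) (sym (trans (sum-const m 1) (*-identityʳ m))))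
                          (trans (∑-children y (λ _ → 1)) (trans (sum-const n 1) (*-identityʳ n))))

    dToEdge : Vertex G → Fin m → ℕ
    dToEdge u k = d u (A k) + d u (B k)

    oneApart-toEdge : ∀ u k → OneApart (d u (A k)) (d u (B k))
    oneApart-toEdge u k with ends-oneApart k u
    ... | inj₁ e = inj₁ (trans (d-sym u (A k)) (trans e (cong suc (d-sym (B k) u))))
    ... | inj₂ e = inj₂ (trans (d-sym u (B k)) (trans e (cong suc (d-sym (A k) u))))

    dToEdge-odd : ∀ u k → dToEdge u k ≡ suc (2 * (d u (A k) Data.Nat.⊓ d u (B k)))
    dToEdge-odd u k = oneApart⇒+≡1+2*⊓ (oneApart-toEdge u k)

    -- side x records whether x is nearer to c than to c'; by counting, cc' is the only edge joining the two sides.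
    module CutEdge (k : Fin m) where
      c c' : Vertex G
      c = A k
      c' = B k

      side : Vertex G → ℕ
      side x = less (d x c) (d x c')

      crossing : Fin m → ℕ
      crossing j = ∣ side (A j) - side (B j) ∣

      choose-child : ∀ (h : Vertex G → ℕ) j y → h (child j y) ≡ choose (d (A j) y <? d (B j) y) (h (A j)) (h (B j))
      choose-child h j y with d (A j) y <? d (B j) y
      ... | yes _ = refl
      ... | no _ = refl

      side-child-shift : ∀ j → side (child j c) + crossing j ≡ side (child j c')
      side-child-shift j rewrite choose-child side j c | choose-child side j c' =
        choose-less-crossing (d (A j) c) (d (B j) c) (d (A j) c') (d (B j) c')
          (ends-oneApart j c) (ends-oneApart j c') (oneApart-toEdge (A j) k) (oneApart-toEdge (B j) k)

      d-cc'≡1 : d c c' ≡ 1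
      d-cc'≡1 with ends-oneApart k c'
      ... | inj₁ e = trans e (cong suc (d-self c'))
      ... | inj₂ e = contradiction (trans (sym (d-self c')) e) 0≢1+n

      d-c'c≡1 : d c' c ≡ 1
      d-c'c≡1 = trans (d-sym c' c) d-cc'≡1

      side-c : side c ≡ 1
      side-c rewrite d-self c | d-cc'≡1 = refl

      side-c' : side c' ≡ 0
      side-c' rewrite d-self c' with d c' c <? 0
      ... | no _ = refl

      ∑-crossing≡1 : ∑[ j < m ] crossing j ≡ 1
      ∑-crossing≡1 = +-cancelˡ-≡ (∑[ j < m ] side (child j c)) _ _ (sym (begin
        ∑[ j < m ] side (child j c) + 1                       ≡⟨ cong (∑[ j < m ] side (child j c) +_) (sym side-c) ⟩
        ∑[ j < m ] side (child j c) + side c                  ≡⟨ ∑-children c side ⟩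
        ∑[ v < n ] side v                                     ≡⟨ sym (∑-children c' side) ⟩
        ∑[ j < m ] side (child j c') + side c'                ≡⟨ cong (∑[ j < m ] side (child j c') +_) side-c' ⟩
        ∑[ j < m ] side (child j c') + 0                      ≡⟨ +-identityʳ _ ⟩
        ∑[ j < m ] side (child j c')                          ≡⟨ sym (sum-cong-≗ side-child-shift) ⟩
        ∑[ j < m ] (side (child j c) + crossing j)            ≡⟨ ∑-distrib-+ (λ j → side (child j c)) crossing ⟩
        ∑[ j < m ] side (child j c) + ∑[ j < m ] crossing j   ∎))
        where open ≡-Reasoning

      crossing-k : crossing k ≡ 1
      crossing-k = cong₂ ∣_-_∣ side-c side-c'

      same-side : ∀ j → ¬ j ≡ k → side (A j) ≡ side (B j)
      same-side j j≢k with crossing j in eq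
      ... | zero = ∣m-n∣≡0⇒m≡n eq
      ... | suc _ = contradiction (∑≤1⇒unique crossing (≤-reflexive ∑-crossing≡1)
                                     (subst (1 ≤_) (sym eq) (s≤s z≤n)) (≤-reflexive (sym crossing-k))) j≢k

      dToEdge-side₁ : ∀ x → side x ≡ 1 → dToEdge x k ≡ suc (2 * d x c)
      dToEdge-side₁ x s₁ rewrite oneApart-less₁ s₁ (oneApart-toEdge x k) = lemma (d x c)
        where lemma : ∀ a → a + suc a ≡ suc (2 * a)
              lemma = solve-∀

      dToEdge-side₀ : ∀ x → side x ≡ 0 → dToEdge x k ≡ suc (2 * d x c')
      dToEdge-side₀ x s₀ rewrite oneApart-less₀ s₀ (oneApart-toEdge x k) = lemma (d x c')
        where lemma : ∀ a → suc a + a ≡ suc (2 * a)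
              lemma = solve-∀

      twoApart-dToEdge : ∀ j → ¬ j ≡ k → TwoApart (dToEdge (A j) k) (dToEdge (B j) k)
      twoApart-dToEdge j j≢k with less≡0⊎less≡1 (d (A j) c) (d (A j) c')
      ... | inj₂ sideA = subst₂ TwoApart (sym (dToEdge-side₁ (A j) sideA)) (sym (dToEdge-side₁ (B j) (trans (sym (same-side j j≢k)) sideA)))
                  (oneApart⇒twoApart-odd (ends-oneApart j c))
      ... | inj₁ sideA = subst₂ TwoApart (sym (dToEdge-side₀ (A j) sideA)) (sym (dToEdge-side₀ (B j) (trans (sym (same-side j j≢k)) sideA)))
                  (oneApart⇒twoApart-odd (ends-oneApart j c'))

      edgeChild : Fin m → Vertex G
      edgeChild i = farEnd dToEdge k (lookup E i)

      private
        not-an-end : ∀ {i u v} → ¬ u ≡ A i → ¬ u ≡ B i → v ≡ A i ⊎ v ≡ B i → ¬ v ≡ u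
        not-an-end u≢A _ (inj₁ refl) v≡u = u≢A (sym v≡u)
        not-an-end _ u≢B (inj₂ refl) v≡u = u≢B (sym v≡u)

      edgeChild-side₁ : ∀ u i → side u ≡ 1 → ¬ i ≡ k → 𝟙 (edgeChild i ≟ u) ≡ 𝟙 (child i c ≟ u)
      edgeChild-side₁ u i s₁ i≢k with u ≟ A i | u ≟ B i
      ... | yes refl | _ = cong (λ v → 𝟙 (v ≟ u))
        (farEnd-1+2* d dToEdge c k (lookup E i) (dToEdge-side₁ (A i) s₁) (dToEdge-side₁ (B i) (trans (sym (same-side i i≢k)) s₁)))
      ... | no _ | yes refl = cong (λ v → 𝟙 (v ≟ u))
        (farEnd-1+2* d dToEdge c k (lookup E i) (dToEdge-side₁ (A i) (trans (same-side i i≢k) s₁)) (dToEdge-side₁ (B i) s₁))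
      ... | no u≢A | no u≢B = trans (𝟙-no (edgeChild i ≟ u) (not-an-end u≢A u≢B (farEnd-end dToEdge k (lookup E i))))
                                    (sym (𝟙-no (child i c ≟ u) (not-an-end u≢A u≢B (farEnd-end d c (lookup E i)))))

      edgeChild-side₀ : ∀ u i → side u ≡ 0 → ¬ i ≡ k → 𝟙 (edgeChild i ≟ u) ≡ 𝟙 (child i c' ≟ u)
      edgeChild-side₀ u i s₀ i≢k with u ≟ A i | u ≟ B i
      ... | yes refl | _ = cong (λ v → 𝟙 (v ≟ u))
        (farEnd-1+2* d dToEdge c' k (lookup E i) (dToEdge-side₀ (A i) s₀) (dToEdge-side₀ (B i) (trans (sym (same-side i i≢k)) s₀)))
      ... | no _ | yes refl = cong (λ v → 𝟙 (v ≟ u))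
        (farEnd-1+2* d dToEdge c' k (lookup E i) (dToEdge-side₀ (A i) (trans (same-side i i≢k) s₀)) (dToEdge-side₀ (B i) s₀))
      ... | no u≢A | no u≢B = trans (𝟙-no (edgeChild i ≟ u) (not-an-end u≢A u≢B (farEnd-end dToEdge k (lookup E i))))
                                    (sym (𝟙-no (child i c' ≟ u) (not-an-end u≢A u≢B (farEnd-end d c' (lookup E i)))))

module Trees where

  open import Data.Nat using (ℕ; zero; suc; _≤_; _<_; s≤s)
  open import Data.Nat.Properties
    using (≤-trans; ≤-reflexive; ≤-antisym; ≤-pred; n≤1+n; 1+n≰n; 1+n≢n)
  open import Data.Fin using (_≟_)
  open import Data.List using (List; []; _∷_; _++_; lookup; length)
  open import Data.List.Membership.Propositional using (_∈_; _∉_; lose)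
  open import Data.List.Membership.Propositional.Properties using (∈-lookup; ∈-++⁻)
  open import Data.List.Relation.Binary.Subset.Propositional using (_⊆_)
  open import Data.List.Relation.Unary.Any using (here; there; index)
  open import Data.List.Relation.Unary.Any.Properties using (lookup-index)
  open import Data.List.Relation.Unary.All using (All; []; _∷_)
  import Data.List.Relation.Unary.All as All
  open import Data.List.Relation.Unary.All.Properties using (¬Any⇒All¬)
  open import Data.List.Relation.Unary.AllPairs using ([]; _∷_)
  open import Data.List.Relation.Unary.Unique.Propositional using (Unique)
  open import Data.List.Relation.Unary.Unique.Propositional.Properties using (++⁺)
  open import Data.Product using (_×_; _,_; proj₁; proj₂; ∃-syntax)
  open import Data.Sum using (_⊎_; inj₁; inj₂)
  open import Data.Empty using (⊥; ⊥-elim)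
  open import Function using (_∘_)
  open import Relation.Binary.PropositionalEquality
  open import Relation.Nullary using (¬_; yes; no; ¬?; contradiction)

  open Sums
  open Distance
  open TreeDistances

  ⊆-snoc : ∀ {A : Set} {i : A} {js is} → js ⊆ is → (js ++ (i ∷ [])) ⊆ (i ∷ is)
  ⊆-snoc {js = js} js⊆is k∈ with ∈-++⁻ js k∈
  ... | inj₁ k∈js = there (js⊆is k∈js)
  ... | inj₂ (here refl) = here refl

  module Walks (G : Graph) where
    open import Data.List.Membership.DecPropositional (_≟_ {length (edges G)}) using (_∈?_)

    A B : EdgeIx G → Vertex G
    A i = proj₁ (lookup (edges G) i)
    B i = proj₂ (lookup (edges G) i)

    step : ∀ {x z y is} i → Joins x z (lookup (edges G) i) → Walk G z y is → Walk G x y (i ∷ is)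
    step i (inj₁ (refl , refl)) w = fwd i w
    step i (inj₂ (refl , refl)) w = bwd i w

    _++ᵂ_ : ∀ {x y z is js} → Walk G x y is → Walk G y z js → Walk G x z (is ++ js)
    here ++ᵂ w' = w'
    fwd i w ++ᵂ w' = fwd i (w ++ᵂ w')
    bwd i w ++ᵂ w' = bwd i (w ++ᵂ w')

    reverse : ∀ {x y is} → Walk G x y is → ∃[ js ] (Walk G y x js × js ⊆ is)
    reverse here = [] , here , λ ()
    reverse (fwd i w) with reverse w
    ... | js , r , js⊆is = js ++ (i ∷ []) , r ++ᵂ bwd i here , ⊆-snoc js⊆is
    reverse (bwd i w) with reverse w
    ... | js , r , js⊆is = js ++ (i ∷ []) , r ++ᵂ fwd i here , ⊆-snoc js⊆is

    Trail : Vertex G → Vertex G → List (EdgeIx G) → Set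
    Trail x y is = ∃[ js ] (Walk G x y js × Unique js × js ⊆ is)

    suffix : ∀ {z y js} → Walk G z y js → Unique js → ∀ {i} → i ∈ js → ∀ {p} → p ≡ A i ⊎ p ≡ B i → Trail p y js
    suffix (fwd j w) u (here refl) (inj₁ refl) = _ , fwd j w , u , λ k∈ → k∈
    suffix (fwd j w) (_ ∷ u) (here refl) (inj₂ refl) = _ , w , u , there
    suffix (bwd j w) (_ ∷ u) (here refl) (inj₁ refl) = _ , w , u , there
    suffix (bwd j w) u (here refl) (inj₂ refl) = _ , bwd j w , u , λ k∈ → k∈
    suffix (fwd j w) (_ ∷ u) (there i∈) p-end with suffix w u i∈ p-end
    ... | ks , w' , u' , ks⊆ = ks , w' , u' , there ∘ ks⊆
    suffix (bwd j w) (_ ∷ u) (there i∈) p-end with suffix w u i∈ p-end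
    ... | ks , w' , u' , ks⊆ = ks , w' , u' , there ∘ ks⊆

    -- A repeated edge is removed by jumping to the suffix after its later occurrence.
    walk⇒trail : ∀ {x y is} → Walk G x y is → Trail x y is
    walk⇒trail here = [] , here , [] , λ ()
    walk⇒trail (fwd i w) with walk⇒trail w
    ... | js , t , u , js⊆ with i ∈? js
    ...   | yes i∈js with suffix t u i∈js (inj₁ refl)
    ...     | ks , t' , u' , ks⊆ = ks , t' , u' , λ k∈ → there (js⊆ (ks⊆ k∈))
    walk⇒trail (fwd i w) | js , t , u , js⊆ | no i∉js =
      i ∷ js , fwd i t , ¬Any⇒All¬ js i∉js ∷ u , λ { (here e) → here e ; (there k∈) → there (js⊆ k∈) }
    walk⇒trail (bwd i w) with walk⇒trail w
    ... | js , t , u , js⊆ with i ∈? js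
    ...   | yes i∈js with suffix t u i∈js (inj₂ refl)
    ...     | ks , t' , u' , ks⊆ = ks , t' , u' , λ k∈ → there (js⊆ (ks⊆ k∈))
    walk⇒trail (bwd i w) | js , t , u , js⊆ | no i∉js =
      i ∷ js , bwd i t , ¬Any⇒All¬ js i∉js ∷ u , λ { (here e) → here e ; (there k∈) → there (js⊆ k∈) }

  module _ (G : Graph) (tree : IsTree G) where
    open Walks G
    private
      d : Vertex G → Vertex G → ℕ
      d = proj₁ (connected⇒distance (proj₁ (proj₂ tree)))
      isDistance : IsDistance G d
      isDistance = proj₂ (connected⇒distance (proj₁ (proj₂ tree)))
      open IsDistance isDistance

      acyclic : ¬ HasCycle G
      acyclic = proj₂ (proj₂ tree)

    Below : Vertex G → ℕ → EdgeIx G → Set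
    Below y j i = (¬ d (A i) y ≡ d (B i) y) × d (A i) y ≤ j × d (B i) y ≤ j

    below-mono : ∀ {y j j'} → j ≤ j' → ∀ {is} → All (Below y j) is → All (Below y j') is
    below-mono j≤j' = All.map λ (ends≢ , A≤ , B≤) → ends≢ , ≤-trans A≤ j≤j' , ≤-trans B≤ j≤j'

    below-step : ∀ {y j x z} i → Joins x z (lookup (edges G) i) → d x y ≡ suc j → d z y ≡ j → Below y (suc j) i
    below-step i (inj₁ (refl , refl)) x≡ z≡ =
      (λ A≡B → 1+n≢n (trans (sym x≡) (trans A≡B z≡))) , ≤-reflexive x≡ , ≤-trans (≤-reflexive z≡) (n≤1+n _)
    below-step i (inj₂ (refl , refl)) x≡ z≡ =
      (λ A≡B → 1+n≢n (trans (sym x≡) (trans (sym A≡B) z≡))) , ≤-trans (≤-reflexive z≡) (n≤1+n _) , ≤-reflexive x≡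

    not-below : ∀ {y j v p} i → Joins v p (lookup (edges G) i) → d v y ≡ suc j → ¬ Below y j i
    not-below i (inj₁ (refl , refl)) v≡ (_ , A≤ , _) = 1+n≰n (≤-trans (≤-reflexive (sym v≡)) A≤)
    not-below i (inj₂ (refl , refl)) v≡ (_ , _ , B≤) = 1+n≰n (≤-trans (≤-reflexive (sym v≡)) B≤)

    descending-walk : ∀ y j x → d x y ≡ j → ∃[ is ] (Walk G x y is × All (Below y j) is)
    descending-walk y zero x x≡0 rewrite d≡0⇒≡ x y x≡0 = [] , here , []
    descending-walk y (suc j) x x≡ with d-descend x y j x≡
    ... | z , adj , z≡ with descending-walk y j z z≡
    ... | is , w , below =
      index adj ∷ is , step (index adj) (lookup-index adj) w , below-step (index adj) (lookup-index adj) x≡ z≡ ∷ below-mono (n≤1+n j) below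

    -- Descending walks from both ends of an edge, joined into a trail, would close a cycle with that edge.
    tree-ends-differ : ∀ i y → ¬ d (A i) y ≡ d (B i) y
    tree-ends-differ i y A≡B with descending-walk y (d (A i) y) (A i) refl | descending-walk y (d (A i) y) (B i) (sym A≡B)
    ... | as , wA , belowA | bs , wB , belowB with reverse wA
    ... | ras , rA , ras⊆as with walk⇒trail (wB ++ᵂ rA)
    ... | qs , t , u , qs⊆ = acyclic (A i , i , qs , ¬Any⇒All¬ qs i∉qs ∷ u , fwd i t)
      where
      i∉qs : i ∉ qs
      i∉qs i∈ with ∈-++⁻ bs (qs⊆ i∈)
      ... | inj₁ i∈bs = proj₁ (All.lookup belowB i∈bs) A≡B
      ... | inj₂ i∈ras = proj₁ (All.lookup belowA (ras⊆as i∈ras)) A≡B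

    -- Two parent edges of v, through p and q, would close a cycle with a descending trail from p to q.
    unique-parent : ∀ y v j i i' → ¬ i ≡ i' → d v y ≡ suc j →
                    farEnd d y (lookup (edges G) i) ≡ v → farEnd d y (lookup (edges G) i') ≡ v → ⊥
    unique-parent y v j i i' i≢i' v≡ far-i far-i'
      with farEnd-closer d y (lookup (edges G) i) (tree-ends-differ i y)
         | farEnd-closer d y (lookup (edges G) i') (tree-ends-differ i' y)
    ... | p , joins-p , p< | q , joins-q , q< rewrite far-i | far-i' =
      cycle (level p joins-p p<) (level q joins-q q<)
      where
      level : ∀ {i} p → Joins v p (lookup (edges G) i) → d p y < d v y → d p y ≡ j
      level {i} p joins p< = ≤-antisym (≤-pred (≤-trans p< (≤-reflexive v≡)))
        (≤-pred (≤-trans (≤-reflexive (sym v≡)) (d-neighbour v p y (lose (∈-lookup i) joins))))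
      cycle : d p y ≡ j → d q y ≡ j → ⊥
      cycle p≡ q≡ with descending-walk y j p p≡ | descending-walk y j q q≡
      ... | ps , wp , belowp | qs' , wq , belowq with reverse wq
      ... | rqs , rq , rqs⊆ with walk⇒trail (wp ++ᵂ rq)
      ... | qs , t , u , qs⊆ =
        acyclic (v , i , qs ++ (i' ∷ []) ,
                 ¬Any⇒All¬ _ (i∉ (i' ∷ []) (λ { (here i≡i') → i≢i' i≡i' })) ∷ ++⁺ u ([] ∷ []) disjoint ,
                 step i joins-p (t ++ᵂ step i' (joins-sym joins-q) here))
        where
        not-on-trail : ∀ {w} k → Joins v w (lookup (edges G) k) → k ∉ qs
        not-on-trail k joins k∈ with ∈-++⁻ ps (qs⊆ k∈)
        ... | inj₁ k∈ps = not-below k joins v≡ (All.lookup belowp k∈ps)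
        ... | inj₂ k∈rqs = not-below k joins v≡ (All.lookup belowq (rqs⊆ k∈rqs))
        i∉ : ∀ ks → i ∉ ks → i ∉ qs ++ ks
        i∉ ks i∉ks i∈ with ∈-++⁻ qs i∈
        ... | inj₁ i∈qs = not-on-trail i joins-p i∈qs
        ... | inj₂ i∈ks = i∉ks i∈ks
        disjoint : ∀ {x} → ¬ (x ∈ qs × x ∈ (i' ∷ []))
        disjoint (i'∈qs , here refl) = not-on-trail i' joins-q i'∈qs

    tree-parentCount : ∀ y v → parentCount G d y v ≡ 𝟙 (¬? (v ≟ y))
    tree-parentCount y v with v ≟ y
    ... | yes refl = trans (sum-cong-≗ (λ i → 𝟙-no (child i ≟ y) (root-no-parent i))) (sum-replicate-zero (length (edges G)))
      where
      child : EdgeIx G → Vertex G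
      child i = farEnd d y (lookup (edges G) i)
      root-no-parent : ∀ i → ¬ child i ≡ y
      root-no-parent i child≡y with farEnd-closer d y (lookup (edges G) i) (tree-ends-differ i y)
      ... | p , _ , p< rewrite child≡y | d-self y with p<
      ...   | ()
    ... | no v≢y with d v y in v≡
    ...   | zero = contradiction (d≡0⇒≡ v y v≡) v≢y
    ...   | suc j = ≤-antisym at-most-one at-least-one
      where
      parent? : EdgeIx G → ℕ
      parent? i = 𝟙 (farEnd d y (lookup (edges G) i) ≟ v)
      at-least-one : 1 ≤ parentCount G d y v
      at-least-one with d-descend v y j v≡
      ... | z , adj , z≡ = ≤-trans (≤-reflexive (sym (𝟙-yes (farEnd d y (lookup (edges G) (index adj)) ≟ v)
                            (farEnd-≡ d y _ (lookup-index adj) (≤-trans (s≤s (≤-reflexive z≡)) (≤-reflexive (sym v≡)))))))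
                           (≤-∑ parent? (index adj))
      at-most-one : parentCount G d y v ≤ 1
      at-most-one = unique⇒∑≤1 parent? (λ i → 𝟙≤1 _) λ {i} {i'} pi pi' → same i i' pi pi'
        where
        same : ∀ i i' → 1 ≤ parent? i → 1 ≤ parent? i' → i ≡ i'
        same i i' pi pi' with i ≟ i'
        ... | yes i≡i' = i≡i'
        ... | no i≢i' = ⊥-elim (unique-parent y v j i i' i≢i' v≡ (𝟙-sound _ pi) (𝟙-sound _ pi'))

    tree⇒treeDistance : TreeDistance G
    tree⇒treeDistance = record
      { d = d
      ; isDistance = isDistance
      ; ends-differ = ends-differ-∈
      ; parentCount≡ = tree-parentCount
      }
      where
      ends-differ-∈ : ∀ {e} → e ∈ edges G → ∀ y → ¬ d (proj₁ e) y ≡ d (proj₂ e) y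
      ends-differ-∈ e∈ y = subst (λ e → ¬ d (proj₁ e) y ≡ d (proj₂ e) y) (sym (lookup-index e∈)) (tree-ends-differ (index e∈) y)

module Subdivision {G : Graph} (τ : TreeDistances.TreeDistance G) where
  open import Data.Nat using (ℕ; zero; suc; _+_; _*_; _≤_; _<_; z≤n; s≤s; _⊓_)
  open import Data.Nat.Properties
    using (≤-refl; ≤-trans; ≤-reflexive; ≤-total; ≤-pred; n≤1+n; 1+n≰n; 1+n≢n; 0≢1+n; suc-injective;
           +-comm; +-suc; +-identityʳ; +-mono-≤; +-monoʳ-≤; *-identityʳ; *-identityˡ; *-zeroʳ;
           ⊓-comm; m⊓n≤m; m≤n⇒m⊓n≡m; m≥n⇒m⊓n≡n; even≢odd)
  open import Data.Nat.Tactic.RingSolver using (solve-∀)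
  open import Data.Fin using (Fin; _≟_; _↑ˡ_; _↑ʳ_; splitAt)
  open import Data.Fin.Properties using (splitAt-↑ˡ; splitAt-↑ʳ; splitAt⁻¹-↑ˡ; splitAt⁻¹-↑ʳ; ↑ˡ-injective; ↑ʳ-injective)
  open import Data.List using (List; []; _∷_; lookup; map; allFin)
  open import Data.List.Membership.Propositional using (_∈_)
  open import Data.List.Membership.Propositional.Properties using (∈-allFin)
  open import Data.List.Relation.Unary.Any using (Any; here; there; satisfied; index)
  import Data.List.Relation.Unary.Any as Any
  open import Data.List.Relation.Unary.Any.Properties using (concat⁺; concat⁻; map⁺; map⁻; lookup-index)
  open import Data.Product using (_×_; _,_; proj₁; proj₂; ∃-syntax)
  open import Data.Sum using (_⊎_; inj₁; inj₂)
  open import Data.Empty using (⊥-elim)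
  open import Relation.Binary.PropositionalEquality
  open import Relation.Nullary using (¬_; yes; no; ¬?; contradiction)

  open Sums
  open Distance
  open Arithmetic
  open TreeDistances

  open TreeDistanceProperties τ

  private
    ≤-resp-≡ : ∀ {a a' b' b} → a ≡ a' → a' ≤ b' → b' ≡ b → a ≤ b
    ≤-resp-≡ refl a'≤b' refl = a'≤b'

  S : Graph
  S = subdivide G

  old : Vertex G → Vertex S
  old u = u ↑ˡ m

  mid : Fin m → Vertex S
  mid i = n ↑ʳ i

  -- In the subdivision, dToEdge u k is the distance from u to the midpoint of edge k and dMid i k the
  -- distance between the midpoints of edges i and k.
  dMid : Fin m → Fin m → ℕ
  dMid i k with i ≟ k
  ... | yes _ = 0
  ... | no _ = suc (dToEdge (A i) k ⊓ dToEdge (B i) k)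

  dMid-self : ∀ i → dMid i i ≡ 0
  dMid-self i with i ≟ i
  ... | yes _ = refl
  ... | no i≢i = contradiction refl i≢i

  dMid-≢ : ∀ i k → ¬ i ≡ k → dMid i k ≡ suc (dToEdge (A i) k ⊓ dToEdge (B i) k)
  dMid-≢ i k i≢k with i ≟ k
  ... | yes i≡k = contradiction i≡k i≢k
  ... | no _ = refl

  d⊎ : Fin n ⊎ Fin m → Fin n ⊎ Fin m → ℕ
  d⊎ (inj₁ u) (inj₁ v) = 2 * d u v
  d⊎ (inj₁ u) (inj₂ k) = dToEdge u k
  d⊎ (inj₂ i) (inj₁ u) = dToEdge u i
  d⊎ (inj₂ i) (inj₂ k) = dMid i k

  d' : Vertex S → Vertex S → ℕ
  d' x y = d⊎ (splitAt n x) (splitAt n y)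

  d'-old-old : ∀ u v → d' (old u) (old v) ≡ 2 * d u v
  d'-old-old u v = cong₂ d⊎ (splitAt-↑ˡ n u m) (splitAt-↑ˡ n v m)

  d'-old-mid : ∀ u k → d' (old u) (mid k) ≡ dToEdge u k
  d'-old-mid u k = cong₂ d⊎ (splitAt-↑ˡ n u m) (splitAt-↑ʳ n m k)

  d'-mid-old : ∀ i u → d' (mid i) (old u) ≡ dToEdge u i
  d'-mid-old i u = cong₂ d⊎ (splitAt-↑ʳ n m i) (splitAt-↑ˡ n u m)

  d'-mid-mid : ∀ i k → d' (mid i) (mid k) ≡ dMid i k
  d'-mid-mid i k = cong₂ d⊎ (splitAt-↑ʳ n m i) (splitAt-↑ʳ n m k)

  d'-mid-mid-≢ : ∀ i k → ¬ i ≡ k → d' (mid i) (mid k) ≡ suc (dToEdge (A i) k ⊓ dToEdge (B i) k)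
  d'-mid-mid-≢ i k i≢k = d'-mid-mid i k ∙ dMid-≢ i k i≢k

  data Kind : Vertex S → Set where
    isOld : ∀ u → Kind (old u)
    isMid : ∀ i → Kind (mid i)

  kind : ∀ x → Kind x
  kind x with splitAt n x in eq
  ... | inj₁ u = subst Kind (splitAt⁻¹-↑ˡ eq) (isOld u)
  ... | inj₂ i = subst Kind (splitAt⁻¹-↑ʳ eq) (isMid i)

  old≢mid : ∀ {u i} → ¬ old u ≡ mid i
  old≢mid {u} {i} eq with trans (sym (splitAt-↑ˡ n u m)) (trans (cong (splitAt n) eq) (splitAt-↑ʳ n m i))
  ... | ()

  old-injective : ∀ {u v} → old u ≡ old v → u ≡ v
  old-injective = ↑ˡ-injective m _ _

  mid-injective : ∀ {i j} → mid i ≡ mid j → i ≡ j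
  mid-injective = ↑ʳ-injective n _ _

  halves : Fin m → List (Vertex S × Vertex S)
  halves i = (old (A i) , mid i) ∷ (mid i , old (B i)) ∷ []

  Ends : Fin m → Vertex G → Vertex G → Set
  Ends i p q = (p ≡ A i × q ≡ B i) ⊎ (p ≡ B i × q ≡ A i)

  HalfOf : Fin m → Vertex S → Vertex S → Set
  HalfOf i x z = ∃[ p ] ∃[ q ] (Ends i p q × ((x ≡ old p × z ≡ mid i) ⊎ (x ≡ mid i × z ≡ old p)))

  adjacentˢ⁻ : ∀ {x z} → Adjacent S x z → ∃[ i ] HalfOf i x z
  adjacentˢ⁻ adj with satisfied (map⁻ (concat⁻ (map halves (allFin m)) adj))
  ... | i , here (inj₁ (x≡ , z≡)) = i , A i , B i , inj₁ (refl , refl) , inj₁ (sym x≡ , sym z≡)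
  ... | i , here (inj₂ (z≡ , x≡)) = i , A i , B i , inj₁ (refl , refl) , inj₂ (sym z≡ , sym x≡)
  ... | i , there (here (inj₁ (x≡ , z≡))) = i , B i , A i , inj₂ (refl , refl) , inj₂ (sym x≡ , sym z≡)
  ... | i , there (here (inj₂ (z≡ , x≡))) = i , B i , A i , inj₂ (refl , refl) , inj₁ (sym z≡ , sym x≡)

  adjacentˢ⁺ : ∀ {x z} i → HalfOf i x z → Adjacent S x z
  adjacentˢ⁺ {x} {z} i half = concat⁺ (map⁺ (Any.map (λ { refl → joins half }) (∈-allFin i)))
    where
    joins : HalfOf i x z → Any (Joins x z) (halves i)
    joins (_ , _ , inj₁ (refl , refl) , inj₁ (refl , refl)) = here (inj₁ (refl , refl))
    joins (_ , _ , inj₁ (refl , refl) , inj₂ (refl , refl)) = here (inj₂ (refl , refl))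
    joins (_ , _ , inj₂ (refl , refl) , inj₁ (refl , refl)) = there (here (inj₂ (refl , refl)))
    joins (_ , _ , inj₂ (refl , refl) , inj₂ (refl , refl)) = there (here (inj₁ (refl , refl)))

  adjacent⇒ends : ∀ {u u'} → Adjacent G u u' → ∃[ i ] Ends i u u'
  adjacent⇒ends adj with lookup-index adj
  ... | inj₁ (A≡ , B≡) = index adj , inj₁ (sym A≡ , sym B≡)
  ... | inj₂ (B≡ , A≡) = index adj , inj₂ (sym B≡ , sym A≡)

  ends⇒adjacent : ∀ {i p q} → Ends i p q → Adjacent G p q
  ends⇒adjacent {i} (inj₁ (refl , refl)) = edge-adjacent i
  ends⇒adjacent {i} (inj₂ (refl , refl)) = adjacent-sym (edge-adjacent i)

  ends-first : ∀ {k u u'} → Ends k u u' → u ≡ A k ⊎ u ≡ B k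
  ends-first (inj₁ (u≡ , _)) = inj₁ u≡
  ends-first (inj₂ (u≡ , _)) = inj₂ u≡

  oneApart-toEnds : ∀ {k p q} → Ends k p q → ∀ x → OneApart (d x p) (d x q)
  oneApart-toEnds {k} (inj₁ (refl , refl)) x = oneApart-toEdge x k
  oneApart-toEnds {k} (inj₂ (refl , refl)) x = oneApart-sym (oneApart-toEdge x k)

  dToEdge-ends : ∀ {i p q} → Ends i p q → ∀ v → dToEdge v i ≡ d v p + d v q
  dToEdge-ends (inj₁ (refl , refl)) v = refl
  dToEdge-ends {i} (inj₂ (refl , refl)) v = +-comm (d v (A i)) (d v (B i))

  ⊓-ends : ∀ {i p q} → Ends i p q → ∀ k → dToEdge (A i) k ⊓ dToEdge (B i) k ≡ dToEdge p k ⊓ dToEdge q k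
  ⊓-ends (inj₁ (refl , refl)) k = refl
  ⊓-ends (inj₂ (refl , refl)) k = ⊓-comm _ _

  dToEdge-own : ∀ {k p q} → Ends k p q → dToEdge p k ≡ 1
  dToEdge-own {k} (inj₁ (refl , refl)) = cong₂ _+_ (d-self (A k)) (CutEdge.d-cc'≡1 k)
  dToEdge-own {k} (inj₂ (refl , refl)) = cong₂ _+_ (CutEdge.d-c'c≡1 k) (d-self (B k))

  d'-old-own-mid : ∀ {k p q} → Ends k p q → d' (old p) (mid k) ≡ 1
  d'-old-own-mid {k} {p} ends = d'-old-mid p k ∙ dToEdge-own ends

  dToEdge-neighbour : ∀ {p q} → Adjacent G p q → ∀ k → dToEdge p k ≤ 2 + dToEdge q k
  dToEdge-neighbour {p} {q} adj k =
    ≤-resp-≡ refl (+-mono-≤ (d-neighbour p q (A k) adj) (d-neighbour p q (B k) adj)) (cong suc (+-suc _ _))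

  d'-self : ∀ x → d' x x ≡ 0
  d'-self x with kind x
  ... | isOld u = d'-old-old u u ∙ cong (2 *_) (d-self u)
  ... | isMid i = d'-mid-mid i i ∙ dMid-self i

  d'≡0⇒≡ : ∀ x y → d' x y ≡ 0 → x ≡ y
  d'≡0⇒≡ x y d'≡0 with kind x | kind y
  ... | isOld u | isOld v = cong old (d≡0⇒≡ u v (half≡0 (sym (d'-old-old u v) ∙ d'≡0)))
    where half≡0 : ∀ {a} → 2 * a ≡ 0 → a ≡ 0
          half≡0 {zero} _ = refl
  ... | isOld u | isMid k = contradiction (sym d'≡0 ∙ d'-old-mid u k ∙ dToEdge-odd u k) 0≢1+n
  ... | isMid i | isOld v = contradiction (sym d'≡0 ∙ d'-mid-old i v ∙ dToEdge-odd v i) 0≢1+n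
  ... | isMid i | isMid k with i ≟ k
  ...   | yes refl = refl
  ...   | no i≢k = contradiction (sym d'≡0 ∙ d'-mid-mid-≢ i k i≢k) 0≢1+n

  d'-neighbour : ∀ x z y → Adjacent S x z → d' x y ≤ suc (d' z y)
  d'-neighbour x z y adj with adjacentˢ⁻ adj
  ... | i , p , q , ends , inj₁ (refl , refl) with kind y
  ...   | isOld v = ≤-resp-≡ (d'-old-old p v) (double≤ (d-neighbour p q v (ends⇒adjacent ends)))
                      (cong suc (cong₂ _+_ (d-sym p v) (d-sym q v) ∙ sym (dToEdge-ends ends v) ∙ sym (d'-mid-old i v)))
    where double≤ : ∀ {a b} → a ≤ suc b → 2 * a ≤ suc (a + b)
          double≤ {a} {b} a≤1+b = ≤-resp-≡ (cong (a +_) (+-identityʳ a)) (+-monoʳ-≤ a a≤1+b) (+-suc a b)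
  ...   | isMid k with i ≟ k
  ...     | yes refl = ≤-resp-≡ (d'-old-mid p i ∙ dToEdge-own ends) (s≤s z≤n) (cong suc (sym (dMid-self i) ∙ sym (d'-mid-mid i i)))
  ...     | no i≢k = ≤-resp-≡ (d'-old-mid p k) (≤2+⊓ (dToEdge-neighbour (ends⇒adjacent ends) k))
                       (cong (λ t → suc (suc t)) (sym (⊓-ends ends k)) ∙ cong suc (sym (d'-mid-mid-≢ i k i≢k)))
    where ≤2+⊓ : ∀ {a b} → a ≤ 2 + b → a ≤ 2 + (a ⊓ b)
          ≤2+⊓ {a} {b} a≤2+b with ≤-total a b
          ... | inj₁ a≤b rewrite m≤n⇒m⊓n≡m a≤b = ≤-trans (n≤1+n a) (n≤1+n (suc a))
          ... | inj₂ b≤a rewrite m≥n⇒m⊓n≡n b≤a = a≤2+b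
  d'-neighbour x z y adj | i , p , q , ends , inj₂ (refl , refl) with kind y
  ...   | isOld v = ≤-resp-≡ (d'-mid-old i v ∙ dToEdge-ends ends v ∙ cong₂ _+_ (d-sym v p) (d-sym v q))
                      (+≤double (d-neighbour q p v (adjacent-sym (ends⇒adjacent ends)))) (cong suc (sym (d'-old-old p v)))
    where +≤double : ∀ {a b} → b ≤ suc a → a + b ≤ suc (2 * a)
          +≤double {a} {b} b≤1+a = ≤-resp-≡ refl (+-monoʳ-≤ a b≤1+a) (+-suc a a ∙ cong (λ t → suc (a + t)) (sym (+-identityʳ a)))
  ...   | isMid k with i ≟ k
  ...     | yes refl = ≤-resp-≡ (d'-self (mid i)) z≤n refl
  ...     | no i≢k = ≤-resp-≡ (d'-mid-mid-≢ i k i≢k ∙ cong suc (⊓-ends ends k)) (s≤s (m⊓n≤m _ _))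
                       (cong suc (sym (d'-old-mid p k)))

  -- From an old vertex u towards the midpoint of edge k = pq with q the farther end: step to the
  -- midpoint of the first edge of a shortest path from u to p.
  d'-descend-old-mid : ∀ u k j p q → Ends k p q → ¬ u ≡ A k → ¬ u ≡ B k → d u q ≡ suc (d u p) →
                       dToEdge u k ≡ suc j → ∃[ z ] (Adjacent S (old u) z × d' z (mid k) ≡ j)
  d'-descend-old-mid u k j p q endsₖ u≢A u≢B uq≡ dToEdge≡ with d u p in up≡
  ... | zero = contradiction (d≡0⇒≡ u p up≡) u≢p
    where u≢p : ¬ u ≡ p
          u≢p refl with ends-first endsₖ
          ... | inj₁ u≡A = u≢A u≡A
          ... | inj₂ u≡B = u≢B u≡B
  ... | suc t with d-descend u p t up≡
  ...   | u' , adj , u'p≡ with adjacent⇒ends adj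
  ...     | i , endsᵢ = mid i , adjacentˢ⁺ i (u , u' , endsᵢ , inj₁ (refl , refl)) , dMid≡j
    where
    i≢k : ¬ i ≡ k
    i≢k refl with ends-first endsᵢ
    ... | inj₁ u≡A = u≢A u≡A
    ... | inj₂ u≡B = u≢B u≡B
    u'q≡ : d u' q ≡ suc t
    u'q≡ with oneApart-toEnds endsₖ u'
    ... | inj₁ p≡1+q = ⊥-elim (1+n≰n (≤-trans (≤-reflexive (sym p≡1+q ∙ u'p≡))
            (≤-trans (n≤1+n t) (≤-pred (≤-trans (≤-reflexive (sym uq≡)) (d-neighbour u u' q adj))))))
    ... | inj₂ q≡1+p = q≡1+p ∙ cong suc u'p≡
    dToEdge-u : dToEdge u k ≡ suc t + suc (suc t)
    dToEdge-u = dToEdge-ends endsₖ u ∙ cong₂ _+_ up≡ uq≡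
    dToEdge-u' : dToEdge u' k ≡ t + suc t
    dToEdge-u' = dToEdge-ends endsₖ u' ∙ cong₂ _+_ u'p≡ u'q≡
    dMid≡j : d' (mid i) (mid k) ≡ j
    dMid≡j = d'-mid-mid-≢ i k i≢k
           ∙ cong suc (⊓-ends endsᵢ k ∙ cong₂ _⊓_ dToEdge-u dToEdge-u'
                       ∙ m≥n⇒m⊓n≡n (≤-trans (+-monoʳ-≤ t (n≤1+n (suc t))) (n≤1+n _)))
           ∙ suc-injective (lemma t ∙ sym dToEdge-u ∙ dToEdge≡)
      where lemma : ∀ t → suc (suc (t + suc t)) ≡ suc t + suc (suc t)
            lemma = solve-∀

  d'-descend : ∀ x y j → d' x y ≡ suc j → ∃[ z ] (Adjacent S x z × d' z y ≡ j)
  d'-descend x y j d'≡ with kind x | kind y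
  ... | isOld u | isOld v with d u v in uv≡
  ...   | zero = contradiction (sym (d'-old-old u v ∙ cong (2 *_) uv≡) ∙ d'≡) 0≢1+n
  ...   | suc t with d-descend u v t uv≡
  ...     | u' , adj , u'v≡ with adjacent⇒ends adj
  ...       | i , ends = mid i , adjacentˢ⁺ i (u , u' , ends , inj₁ (refl , refl)) ,
                (d'-mid-old i v ∙ dToEdge-ends ends v ∙ cong₂ _+_ (d-sym v u ∙ uv≡) (d-sym v u' ∙ u'v≡)
                 ∙ suc-injective (lemma t ∙ sym (d'-old-old u v ∙ cong (2 *_) uv≡) ∙ d'≡))
    where lemma : ∀ t → suc (suc t + t) ≡ 2 * suc t
          lemma = solve-∀
  d'-descend x y j d'≡ | isOld u | isMid k with u ≟ A k | u ≟ B k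
  ... | yes refl | _ = mid k , adjacentˢ⁺ k (A k , B k , inj₁ (refl , refl) , inj₁ (refl , refl)) ,
                        (d'-self (mid k) ∙ suc-injective (sym (d'-old-own-mid {k} (inj₁ (refl , refl))) ∙ d'≡))
  ... | no _ | yes refl = mid k , adjacentˢ⁺ k (B k , A k , inj₂ (refl , refl) , inj₁ (refl , refl)) ,
                        (d'-self (mid k) ∙ suc-injective (sym (d'-old-own-mid {k} (inj₂ (refl , refl))) ∙ d'≡))
  ... | no u≢A | no u≢B with oneApart-toEdge u k
  ...   | inj₁ A≡1+B = d'-descend-old-mid u k j (B k) (A k) (inj₂ (refl , refl)) u≢A u≢B A≡1+B (sym (d'-old-mid u k) ∙ d'≡)
  ...   | inj₂ B≡1+A = d'-descend-old-mid u k j (A k) (B k) (inj₁ (refl , refl)) u≢A u≢B B≡1+A (sym (d'-old-mid u k) ∙ d'≡)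
  d'-descend x y j d'≡ | isMid i | isOld v with oneApart-toEdge v i
  ... | inj₁ A≡1+B = old (B i) , adjacentˢ⁺ i (B i , A i , inj₂ (refl , refl) , inj₂ (refl , refl)) ,
                   (d'-old-old (B i) v ∙ cong (2 *_) (d-sym (B i) v)
                    ∙ suc-injective (lemma (d v (B i)) ∙ cong (_+ d v (B i)) (sym A≡1+B) ∙ sym (d'-mid-old i v) ∙ d'≡))
    where lemma : ∀ a → suc (2 * a) ≡ suc a + a
          lemma = solve-∀
  ... | inj₂ B≡1+A = old (A i) , adjacentˢ⁺ i (A i , B i , inj₁ (refl , refl) , inj₂ (refl , refl)) ,
                   (d'-old-old (A i) v ∙ cong (2 *_) (d-sym (A i) v)
                    ∙ suc-injective (lemma (d v (A i)) ∙ cong (d v (A i) +_) (sym B≡1+A) ∙ sym (d'-mid-old i v) ∙ d'≡))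
    where lemma : ∀ a → suc (2 * a) ≡ a + suc a
          lemma = solve-∀
  d'-descend x y j d'≡ | isMid i | isMid k with i ≟ k
  ... | yes refl = contradiction (sym (d'-self (mid i)) ∙ d'≡) 0≢1+n
  ... | no i≢k with ≤-total (dToEdge (A i) k) (dToEdge (B i) k)
  ...   | inj₁ A≤B = old (A i) , adjacentˢ⁺ i (A i , B i , inj₁ (refl , refl) , inj₂ (refl , refl)) ,
                     (d'-old-mid (A i) k ∙ sym (m≤n⇒m⊓n≡m A≤B) ∙ suc-injective (sym (d'-mid-mid-≢ i k i≢k) ∙ d'≡))
  ...   | inj₂ B≤A = old (B i) , adjacentˢ⁺ i (B i , A i , inj₂ (refl , refl) , inj₂ (refl , refl)) ,
                     (d'-old-mid (B i) k ∙ sym (m≥n⇒m⊓n≡n B≤A) ∙ suc-injective (sym (d'-mid-mid-≢ i k i≢k) ∙ d'≡))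

  isDistanceˢ : IsDistance S d'
  isDistanceˢ = record { d-self = d'-self ; d≡0⇒≡ = d'≡0⇒≡ ; d-neighbour = d'-neighbour ; d-descend = d'-descend }

  -- The two ends of a half-edge are at distances of different parity from every vertex.
  old≢mid-distance : ∀ {i p q} → Ends i p q → ∀ y → ¬ d' (old p) y ≡ d' (mid i) y
  old≢mid-distance {i} {p} {q} ends y eq with kind y
  ... | isOld v = even≢odd (d p v) (d v (A i) ⊓ d v (B i)) (sym (d'-old-old p v) ∙ eq ∙ d'-mid-old i v ∙ dToEdge-odd v i)
  ... | isMid k with i ≟ k
  ...   | yes refl = 0≢1+n (sym (sym (d'-old-own-mid ends) ∙ eq ∙ d'-self (mid i)))
  ...   | no i≢k with ≤-total (dToEdge p k) (dToEdge q k)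
  ...     | inj₁ p≤q =
    1+n≢n (sym (sym (d'-old-mid p k) ∙ eq ∙ d'-mid-mid-≢ i k i≢k ∙ cong suc (⊓-ends ends k ∙ m≤n⇒m⊓n≡m p≤q)))
  ...     | inj₂ q≤p = even≢odd (d p (A k) ⊓ d p (B k)) (d q (A k) ⊓ d q (B k)) (suc-injective
      (sym (dToEdge-odd p k) ∙ sym (d'-old-mid p k) ∙ eq ∙ d'-mid-mid-≢ i k i≢k
       ∙ cong suc (⊓-ends ends k ∙ m≥n⇒m⊓n≡n q≤p ∙ dToEdge-odd q k)))

  ends-differˢ : ∀ {e} → e ∈ edges S → ∀ y → ¬ d' (proj₁ e) y ≡ d' (proj₂ e) y
  ends-differˢ e∈ y with satisfied (map⁻ (concat⁻ (map halves (allFin m)) e∈))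
  ... | i , here refl = old≢mid-distance {i} (inj₁ (refl , refl)) y
  ... | i , there (here refl) = λ eq → old≢mid-distance {i} (inj₂ (refl , refl)) y (sym eq)

  farEnd-snd : ∀ {a b} y → d' a y < d' b y → farEnd d' y (a , b) ≡ b
  farEnd-snd {a} {b} y a<b = farEnd-≡ d' y (a , b) {b} {a} (inj₂ (refl , refl)) a<b

  farEnd-fst : ∀ {a b} y → d' b y < d' a y → farEnd d' y (a , b) ≡ a
  farEnd-fst {a} {b} y b<a = farEnd-≡ d' y (a , b) {a} {b} (inj₁ (refl , refl)) b<a

  farEnd₁ farEnd₂ : Vertex S → Fin m → Vertex S
  farEnd₁ y i = farEnd d' y (old (A i) , mid i)
  farEnd₂ y i = farEnd d' y (mid i , old (B i))

  FarEndsFrom : Vertex S → Fin m → Vertex G → Set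
  FarEndsFrom y i u = (farEnd₁ y i ≡ old (A i) × farEnd₂ y i ≡ mid i × u ≡ A i)
                    ⊎ (farEnd₁ y i ≡ mid i × farEnd₂ y i ≡ old (B i) × u ≡ B i)

  d'-mid-old-ends : ∀ v i → d' (mid i) (old v) ≡ d (A i) v + d (B i) v
  d'-mid-old-ends v i = d'-mid-old i v ∙ cong₂ _+_ (d-sym v (A i)) (d-sym v (B i))

  farEnds-from-old : ∀ v i → FarEndsFrom (old v) i (child i v)
  farEnds-from-old v i with ends-oneApart i v
  ... | inj₁ A≡1+B = inj₁
    ( farEnd-fst (old v) (≤-resp-≡ (cong suc (d'-mid-old-ends v i ∙ cong (_+ d (B i) v) A≡1+B)) (≤-reflexive (lemma₁ (d (B i) v)))
                                   (cong (2 *_) (sym A≡1+B) ∙ sym (d'-old-old (A i) v)))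
    , farEnd-fst (old v) (≤-resp-≡ (cong suc (d'-old-old (B i) v)) (≤-reflexive (lemma₂ (d (B i) v)))
                                   (sym (d'-mid-old-ends v i ∙ cong (_+ d (B i) v) A≡1+B)))
    , farEnd-≡ d v (lookup E i) {A i} {B i} (inj₁ (refl , refl)) (≤-reflexive (sym A≡1+B)))
    where lemma₁ : ∀ b → suc (suc b + b) ≡ 2 * suc b
          lemma₁ = solve-∀
          lemma₂ : ∀ b → suc (2 * b) ≡ suc b + b
          lemma₂ = solve-∀
  ... | inj₂ B≡1+A = inj₂
    ( farEnd-snd (old v) (≤-resp-≡ (cong suc (d'-old-old (A i) v)) (≤-reflexive (lemma₁ (d (A i) v)))
                                   (sym (d'-mid-old-ends v i ∙ cong (d (A i) v +_) B≡1+A)))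
    , farEnd-snd (old v) (≤-resp-≡ (cong suc (d'-mid-old-ends v i ∙ cong (d (A i) v +_) B≡1+A)) (≤-reflexive (lemma₂ (d (A i) v)))
                                   (cong (2 *_) (sym B≡1+A) ∙ sym (d'-old-old (B i) v)))
    , farEnd-≡ d v (lookup E i) {B i} {A i} (inj₂ (refl , refl)) (≤-reflexive (sym B≡1+A)))
    where lemma₁ : ∀ a → suc (2 * a) ≡ a + suc a
          lemma₁ = solve-∀
          lemma₂ : ∀ a → suc (a + suc a) ≡ 2 * suc a
          lemma₂ = solve-∀

  farEnds-from-own-mid : ∀ k → farEnd₁ (mid k) k ≡ old (A k) × farEnd₂ (mid k) k ≡ old (B k)
  farEnds-from-own-mid k =
    farEnd-fst (mid k) (≤-resp-≡ (cong suc (d'-self (mid k))) ≤-refl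
                                 (sym (d'-old-own-mid {k} (inj₁ (refl , refl))))) ,
    farEnd-snd (mid k) (≤-resp-≡ (cong suc (d'-self (mid k))) ≤-refl
                                 (sym (d'-old-own-mid {k} (inj₂ (refl , refl)))))

  farEnds-from-mid : ∀ k i → ¬ i ≡ k → FarEndsFrom (mid k) i (CutEdge.edgeChild k i)
  farEnds-from-mid k i i≢k with CutEdge.twoApart-dToEdge k i i≢k
  ... | inj₁ A≡2+B = inj₁
    ( farEnd-fst (mid k) (≤-resp-≡ (cong suc dMid≡) (≤-reflexive (sym A≡2+B)) (sym (d'-old-mid (A i) k)))
    , farEnd-fst (mid k) (≤-resp-≡ (cong suc (d'-old-mid (B i) k)) ≤-refl (sym dMid≡))
    , farEnd-≡ dToEdge k (lookup E i) {A i} {B i} (inj₁ (refl , refl)) (≤-trans (n≤1+n _) (≤-reflexive (sym A≡2+B))))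
    where
    dMid≡ : d' (mid i) (mid k) ≡ suc (dToEdge (B i) k)
    dMid≡ = d'-mid-mid-≢ i k i≢k
          ∙ cong suc (m≥n⇒m⊓n≡n (≤-trans (n≤1+n _) (≤-trans (n≤1+n _) (≤-reflexive (sym A≡2+B)))))
  ... | inj₂ B≡2+A = inj₂
    ( farEnd-snd (mid k) (≤-resp-≡ (cong suc (d'-old-mid (A i) k)) ≤-refl (sym dMid≡))
    , farEnd-snd (mid k) (≤-resp-≡ (cong suc dMid≡) (≤-reflexive (sym B≡2+A)) (sym (d'-old-mid (B i) k)))
    , farEnd-≡ dToEdge k (lookup E i) {B i} {A i} (inj₂ (refl , refl)) (≤-trans (n≤1+n _) (≤-reflexive (sym B≡2+A))))
    where
    dMid≡ : d' (mid i) (mid k) ≡ suc (dToEdge (A i) k)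
    dMid≡ = d'-mid-mid-≢ i k i≢k
          ∙ cong suc (m≤n⇒m⊓n≡m (≤-trans (n≤1+n _) (≤-trans (n≤1+n _) (≤-reflexive (sym B≡2+A)))))

  private
    𝟙-old≟old : ∀ u v → 𝟙 (old u ≟ old v) ≡ 𝟙 (u ≟ v)
    𝟙-old≟old = 𝟙-≟-injective _≟_ _≟_ old old-injective

    𝟙-mid≟mid : ∀ i j → 𝟙 (mid i ≟ mid j) ≡ 𝟙 (i ≟ j)
    𝟙-mid≟mid = 𝟙-≟-injective _≟_ _≟_ mid mid-injective

    𝟙-mid≟old : ∀ i u → 𝟙 (mid i ≟ old u) ≡ 0
    𝟙-mid≟old i u = 𝟙-no (mid i ≟ old u) (λ eq → old≢mid (sym eq))

    𝟙-old≟mid : ∀ u i → 𝟙 (old u ≟ mid i) ≡ 0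
    𝟙-old≟mid u i = 𝟙-no (old u ≟ mid i) old≢mid

  halfParents : Vertex S → Vertex S → Fin m → ℕ
  halfParents y x i = 𝟙 (farEnd₁ y i ≟ x) + (𝟙 (farEnd₂ y i ≟ x) + 0)

  parentCountˢ≡ : ∀ y x → parentCount S d' y x ≡ ∑[ i < m ] halfParents y x i
  parentCountˢ≡ y x =
    ∑-lookup (edges S) (λ e → 𝟙 (farEnd d' y e ≟ x)) ∙ sumˡ-concat-allFin m halves (λ e → 𝟙 (farEnd d' y e ≟ x))

  halfParents-old : ∀ {y i u} → FarEndsFrom y i u → ∀ v → halfParents y (old v) i ≡ 𝟙 (u ≟ v)
  halfParents-old {i = i} (inj₁ (far₁ , far₂ , refl)) v rewrite far₁ | far₂ | 𝟙-old≟old (A i) v | 𝟙-mid≟old i v = +-identityʳ _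
  halfParents-old {i = i} (inj₂ (far₁ , far₂ , refl)) v rewrite far₁ | far₂ | 𝟙-old≟old (B i) v | 𝟙-mid≟old i v = +-identityʳ _

  halfParents-mid : ∀ {y i u} → FarEndsFrom y i u → ∀ j → halfParents y (mid j) i ≡ 𝟙 (i ≟ j)
  halfParents-mid {i = i} (inj₁ (far₁ , far₂ , _)) j rewrite far₁ | far₂ | 𝟙-old≟mid (A i) j | 𝟙-mid≟mid i j = +-identityʳ _
  halfParents-mid {i = i} (inj₂ (far₁ , far₂ , _)) j rewrite far₁ | far₂ | 𝟙-old≟mid (B i) j | 𝟙-mid≟mid i j = +-identityʳ _

  halfParents-own-mid : ∀ k x → halfParents (mid k) x k ≡ 𝟙 (old (A k) ≟ x) + 𝟙 (old (B k) ≟ x)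
  halfParents-own-mid k x rewrite proj₁ (farEnds-from-own-mid k) | proj₂ (farEnds-from-own-mid k) =
    cong (𝟙 (old (A k) ≟ x) +_) (+-identityʳ _)

  halfParents-mid-mid : ∀ k j i → halfParents (mid k) (mid j) i ≡ 𝟙 (i ≟ j) * 𝟙 (¬? (j ≟ k))
  halfParents-mid-mid k j i with i ≟ k
  ... | yes refl rewrite halfParents-own-mid i (mid j) | 𝟙-old≟mid (A i) j | 𝟙-old≟mid (B i) j with j ≟ i
  ...   | yes refl = sym (*-zeroʳ (𝟙 (i ≟ i)))
  ...   | no j≢i = sym (cong (_* 1) (𝟙-no (i ≟ j) (λ i≡j → j≢i (sym i≡j))))
  halfParents-mid-mid k j i | no i≢k rewrite halfParents-mid (farEnds-from-mid k i i≢k) j with i ≟ j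
  ... | yes refl = sym (*-identityˡ _ ∙ 𝟙-yes (¬? (i ≟ k)) i≢k)
  ... | no _ = refl

  child-own₁ : ∀ k → child k (A k) ≡ B k
  child-own₁ k = farEnd-≡ d (A k) (lookup E k) {B k} {A k} (inj₂ (refl , refl))
                   (≤-reflexive (cong suc (d-self (A k)) ∙ sym (CutEdge.d-c'c≡1 k)))

  child-own₂ : ∀ k → child k (B k) ≡ A k
  child-own₂ k = farEnd-≡ d (B k) (lookup E k) {A k} {B k} (inj₁ (refl , refl))
                   (≤-reflexive (cong suc (d-self (B k)) ∙ sym (CutEdge.d-cc'≡1 k)))

  halfParents-mid-old₁ : ∀ k u i → CutEdge.side k u ≡ 1 →
                         halfParents (mid k) (old u) i ≡ 𝟙 (child i (A k) ≟ u) + 𝟙 (i ≟ k) * 𝟙 (A k ≟ u)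
  halfParents-mid-old₁ k u i s₁ with i ≟ k
  ... | yes refl rewrite child-own₁ i | halfParents-own-mid i (old u) | 𝟙-old≟old (A i) u | 𝟙-old≟old (B i) u =
    +-comm (𝟙 (A i ≟ u)) _ ∙ cong (𝟙 (B i ≟ u) +_) (sym (+-identityʳ _))
  ... | no i≢k = halfParents-old (farEnds-from-mid k i i≢k) u ∙ CutEdge.edgeChild-side₁ k u i s₁ i≢k ∙ sym (+-identityʳ _)

  halfParents-mid-old₀ : ∀ k u i → CutEdge.side k u ≡ 0 →
                         halfParents (mid k) (old u) i ≡ 𝟙 (child i (B k) ≟ u) + 𝟙 (i ≟ k) * 𝟙 (B k ≟ u)
  halfParents-mid-old₀ k u i s₀ with i ≟ k
  ... | yes refl rewrite child-own₂ i | halfParents-own-mid i (old u) | 𝟙-old≟old (A i) u | 𝟙-old≟old (B i) u =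
    cong (𝟙 (A i ≟ u) +_) (sym (+-identityʳ _))
  ... | no i≢k = halfParents-old (farEnds-from-mid k i i≢k) u ∙ CutEdge.edgeChild-side₀ k u i s₀ i≢k ∙ sym (+-identityʳ _)

  ∑-children+own : ∀ c u (k : Fin m) → ∑[ i < m ] (𝟙 (child i c ≟ u) + 𝟙 (i ≟ k) * 𝟙 (c ≟ u)) ≡ 1
  ∑-children+own c u k = ∑-distrib-+ (λ i → 𝟙 (child i c ≟ u)) (λ i → 𝟙 (i ≟ k) * 𝟙 (c ≟ u))
    ∙ cong₂ _+_ (parentCount≡ c u) (∑-𝟙-≟ k (𝟙 (c ≟ u)))
    ∙ cong (𝟙 (¬? (u ≟ c)) +_) (𝟙-≟-sym c u) ∙ 𝟙-¬?+𝟙 (u ≟ c)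

  parentCountˢ : ∀ y x → parentCount S d' y x ≡ 𝟙 (¬? (x ≟ y))
  parentCountˢ y x with kind y | kind x
  ... | isOld v | isOld u = parentCountˢ≡ (old v) (old u) ∙ sum-cong-≗ (λ i → halfParents-old (farEnds-from-old v i) u)
                            ∙ parentCount≡ v u ∙ sym (𝟙-¬?-cong (old u ≟ old v) (u ≟ v) (𝟙-old≟old u v))
  ... | isOld v | isMid j = parentCountˢ≡ (old v) (mid j)
                            ∙ sum-cong-≗ (λ i → halfParents-mid (farEnds-from-old v i) j ∙ sym (*-identityʳ _))
                            ∙ ∑-𝟙-≟ j 1 ∙ sym (𝟙-yes (¬? (mid j ≟ old v)) (λ eq → old≢mid (sym eq)))
  ... | isMid k | isMid j = parentCountˢ≡ (mid k) (mid j) ∙ sum-cong-≗ (halfParents-mid-mid k j) ∙ ∑-𝟙-≟ j (𝟙 (¬? (j ≟ k)))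
                            ∙ sym (𝟙-¬?-cong (mid j ≟ mid k) (j ≟ k) (𝟙-mid≟mid j k))
  ... | isMid k | isOld u with less≡0⊎less≡1 (d u (A k)) (d u (B k))
  ...   | inj₂ s₁ = parentCountˢ≡ (mid k) (old u) ∙ sum-cong-≗ (λ i → halfParents-mid-old₁ k u i s₁) ∙ ∑-children+own (A k) u k
                    ∙ sym (𝟙-yes (¬? (old u ≟ mid k)) old≢mid)
  ...   | inj₁ s₀ = parentCountˢ≡ (mid k) (old u) ∙ sum-cong-≗ (λ i → halfParents-mid-old₀ k u i s₀) ∙ ∑-children+own (B k) u k
                    ∙ sym (𝟙-yes (¬? (old u ≟ mid k)) old≢mid)

  subdivide-treeDistance : TreeDistance S
  subdivide-treeDistance = record
    { d = d' ; isDistance = isDistanceˢ ; ends-differ = ends-differˢ ; parentCount≡ = parentCountˢ }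

module WienerStep {G : Graph} (τ : TreeDistances.TreeDistance G) where
  open import Data.Nat using (ℕ; _+_; _*_)
  open import Data.Nat.Properties using (+-identityʳ; *-identityʳ; *-assoc; *-distribˡ-+; *-cancelˡ-≡)
  open import Data.Nat.Tactic.RingSolver using (solve-∀)
  open import Data.Fin using (_≟_)
  open import Data.Sum using (inj₁; inj₂)
  open import Data.Product using (_,_)
  open import Relation.Binary.PropositionalEquality
  open import Relation.Nullary using (Dec; yes; no)

  open Sums
  open Arithmetic using (twoApart⇒2*1+⊓≡+)
  open TreeDistances

  open TreeDistanceProperties τ
  open Subdivision τ

  ∑∑d : ℕ
  ∑∑d = ∑[ u < n ] ∑[ v < n ] d u v

  ∑∑d' : ℕ
  ∑∑d' = ∑[ x < n + m ] ∑[ y < n + m ] d' x y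

  ∑∑dToEdge : ℕ
  ∑∑dToEdge = ∑[ u < n ] ∑[ k < m ] dToEdge u k

  ∑∑dMid : ℕ
  ∑∑dMid = ∑[ i < m ] ∑[ k < m ] dMid i k

  ∑∑d'≡ : ∑∑d' ≡ 2 * ∑∑d + ∑∑dToEdge + (∑∑dToEdge + ∑∑dMid)
  ∑∑d'≡ = ∑-↑ n m _ ∙ cong₂ _+_
    (sum-cong-≗ (λ u → ∑-↑ n m _ ∙ cong₂ _+_ (sum-cong-≗ (d'-old-old u)) (sum-cong-≗ (d'-old-mid u)))
     ∙ ∑-distrib-+ (λ u → ∑[ v < n ] (2 * d u v)) (λ u → ∑[ k < m ] dToEdge u k)
     ∙ cong (_+ ∑∑dToEdge) (sum-cong-≗ (λ u → sym (*-distribˡ-sum 2 (d u))) ∙ sym (*-distribˡ-sum 2 (λ u → ∑[ v < n ] d u v))))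
    (sum-cong-≗ (λ i → ∑-↑ n m _ ∙ cong₂ _+_ (sum-cong-≗ (d'-mid-old i)) (sum-cong-≗ (d'-mid-mid i)))
     ∙ ∑-distrib-+ (λ i → ∑[ v < n ] dToEdge v i) (λ i → ∑[ k < m ] dMid i k)
     ∙ cong (_+ ∑∑dMid) (∑-comm (λ i v → dToEdge v i)))

  ∑∑dToEdge+nm≡ : ∑∑dToEdge + n * m ≡ 2 * ∑∑d
  ∑∑dToEdge+nm≡ =
    cong (∑∑dToEdge +_) (sym (sum-const n m)) ∙ sym (∑-distrib-+ (λ u → ∑[ k < m ] dToEdge u k) (λ _ → m))
    ∙ sum-cong-≗ row ∙ sym (*-distribˡ-sum 2 totalDistance) ∙ cong (2 *_) (∑-comm (λ v u → d u v))
    where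
    row : ∀ u → ∑[ k < m ] dToEdge u k + m ≡ 2 * totalDistance u
    row u = cong (_+ m) (sum-cong-≗ (λ k → cong₂ _+_ (d-sym u (A k)) (d-sym u (B k)))) ∙ ∑-ends u

  2*dMid-ends : ∀ k i → 2 * dMid i k + 2 * 𝟙 (i ≟ k) ≡ dToEdge (A i) k + dToEdge (B i) k
  2*dMid-ends k i = by-cases (i ≟ k)
    where
    by-cases : Dec (i ≡ k) → 2 * dMid i k + 2 * 𝟙 (i ≟ k) ≡ dToEdge (A i) k + dToEdge (B i) k
    by-cases (yes refl) = cong₂ (λ a b → 2 * a + 2 * b) (dMid-self i) (𝟙-yes (i ≟ i) refl)
                          ∙ sym (cong₂ _+_ (dToEdge-own {i} (inj₁ (refl , refl))) (dToEdge-own {i} (inj₂ (refl , refl))))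
    by-cases (no i≢k) = cong₂ (λ a b → 2 * a + 2 * b) (dMid-≢ i k i≢k) (𝟙-no (i ≟ k) i≢k) ∙ +-identityʳ _
                        ∙ twoApart⇒2*1+⊓≡+ (CutEdge.twoApart-dToEdge k i i≢k)

  ∑dMid-column : ∀ k → 2 * ∑[ i < m ] dMid i k + 2 + 2 * m ≡ 2 * (totalDistance (A k) + totalDistance (B k))
  ∑dMid-column k = begin
    2 * ∑[ i < m ] dMid i k + 2 + 2 * m
      ≡⟨ cong (λ t → 2 * ∑[ i < m ] dMid i k + 2 * t + 2 * m) (sym (∑-𝟙-≟ k 1)) ⟩
    2 * ∑[ i < m ] dMid i k + 2 * ∑[ i < m ] (𝟙 (i ≟ k) * 1) + 2 * m
      ≡⟨ cong (_+ 2 * m) (cong₂ _+_ (*-distribˡ-sum 2 (λ i → dMid i k)) (*-distribˡ-sum 2 (λ i → 𝟙 (i ≟ k) * 1))) ⟩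
    ∑[ i < m ] (2 * dMid i k) + ∑[ i < m ] (2 * (𝟙 (i ≟ k) * 1)) + 2 * m
      ≡⟨ cong (_+ 2 * m) (sym (∑-distrib-+ (λ i → 2 * dMid i k) (λ i → 2 * (𝟙 (i ≟ k) * 1)))) ⟩
    ∑[ i < m ] (2 * dMid i k + 2 * (𝟙 (i ≟ k) * 1)) + 2 * m
      ≡⟨ cong (_+ 2 * m) (sum-cong-≗ (λ i → cong (λ t → 2 * dMid i k + 2 * t) (*-identityʳ (𝟙 (i ≟ k))) ∙ 2*dMid-ends k i)) ⟩
    ∑[ i < m ] (dToEdge (A i) k + dToEdge (B i) k) + 2 * m
      ≡⟨ cong (_+ 2 * m) (sum-cong-≗ (λ i → regroup (d (A i) (A k)) (d (A i) (B k)) (d (B i) (A k)) (d (B i) (B k)))) ⟩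
    ∑[ i < m ] ((d (A i) (A k) + d (B i) (A k)) + (d (A i) (B k) + d (B i) (B k))) + 2 * m
      ≡⟨ cong (_+ 2 * m) (∑-distrib-+ (λ i → d (A i) (A k) + d (B i) (A k)) (λ i → d (A i) (B k) + d (B i) (B k))) ⟩
    ∑[ i < m ] (d (A i) (A k) + d (B i) (A k)) + ∑[ i < m ] (d (A i) (B k) + d (B i) (B k)) + 2 * m
      ≡⟨ share-m (∑[ i < m ] (d (A i) (A k) + d (B i) (A k))) (∑[ i < m ] (d (A i) (B k) + d (B i) (B k))) m ⟩
    (∑[ i < m ] (d (A i) (A k) + d (B i) (A k)) + m) + (∑[ i < m ] (d (A i) (B k) + d (B i) (B k)) + m)
      ≡⟨ cong₂ _+_ (∑-ends (A k)) (∑-ends (B k)) ⟩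
    2 * totalDistance (A k) + 2 * totalDistance (B k)
      ≡⟨ sym (*-distribˡ-+ 2 (totalDistance (A k)) (totalDistance (B k))) ⟩
    2 * (totalDistance (A k) + totalDistance (B k)) ∎
    where
    open ≡-Reasoning
    regroup : ∀ a b c d → (a + b) + (c + d) ≡ (a + c) + (b + d)
    regroup = solve-∀
    share-m : ∀ x y m → x + y + 2 * m ≡ (x + m) + (y + m)
    share-m = solve-∀

  ∑∑dMid+m+m²≡ : ∑∑dMid + m + m * m ≡ ∑∑dToEdge
  ∑∑dMid+m+m²≡ = *-cancelˡ-≡ _ _ 2 (begin
    2 * (∑∑dMid + m + m * m)
      ≡⟨ distribute ∑∑dMid m ⟩
    2 * ∑∑dMid + m * 2 + m * (2 * m)
      ≡⟨ cong (λ t → 2 * t + m * 2 + m * (2 * m)) (∑-comm dMid) ⟩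
    2 * ∑[ k < m ] ∑[ i < m ] dMid i k + m * 2 + m * (2 * m)
      ≡⟨ sym columns ⟩
    ∑[ k < m ] (2 * ∑[ i < m ] dMid i k + 2 + 2 * m)
      ≡⟨ sum-cong-≗ ∑dMid-column ⟩
    ∑[ k < m ] (2 * (totalDistance (A k) + totalDistance (B k)))
      ≡⟨ sym (*-distribˡ-sum 2 (λ k → totalDistance (A k) + totalDistance (B k))) ⟩
    2 * ∑[ k < m ] (totalDistance (A k) + totalDistance (B k))
      ≡⟨ cong (2 *_) (sum-cong-≗ (λ k → sym (∑-distrib-+ (λ v → d v (A k)) (λ v → d v (B k))))
                     ∙ ∑-comm (λ k v → dToEdge v k)) ⟩
    2 * ∑∑dToEdge ∎)
    where
    open ≡-Reasoning
    distribute : ∀ x m → 2 * (x + m + m * m) ≡ 2 * x + m * 2 + m * (2 * m)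
    distribute = solve-∀
    columns : ∑[ k < m ] (2 * ∑[ i < m ] dMid i k + 2 + 2 * m) ≡ 2 * ∑[ k < m ] ∑[ i < m ] dMid i k + m * 2 + m * (2 * m)
    columns = ∑-distrib-+ (λ k → 2 * ∑[ i < m ] dMid i k + 2) (λ _ → 2 * m)
            ∙ cong₂ _+_ (∑-distrib-+ (λ k → 2 * ∑[ i < m ] dMid i k) (λ _ → 2)
                         ∙ cong₂ _+_ (sym (*-distribˡ-sum 2 (λ k → ∑[ i < m ] dMid i k))) (sum-const m 2))
                        (sum-const m (2 * m))

  ∑∑d'-subdivide : n ≡ m + 1 → ∑∑d' + 4 * m + 4 * (m * m) ≡ 8 * ∑∑d
  ∑∑d'-subdivide n≡m+1 = begin
    ∑∑d' + 4 * m + 4 * (m * m)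
      ≡⟨ cong (λ t → t + 4 * m + 4 * (m * m)) ∑∑d'≡ ⟩
    2 * ∑∑d + ∑∑dToEdge + (∑∑dToEdge + ∑∑dMid) + 4 * m + 4 * (m * m)
      ≡⟨ cong (λ t → t + ∑∑dToEdge + (∑∑dToEdge + ∑∑dMid) + 4 * m + 4 * (m * m)) (sym ∑∑dToEdge+nm≡) ⟩
    ∑∑dToEdge + n * m + ∑∑dToEdge + (∑∑dToEdge + ∑∑dMid) + 4 * m + 4 * (m * m)
      ≡⟨ cong₂ (λ x y → y + x * m + y + (y + ∑∑dMid) + 4 * m + 4 * (m * m)) n≡m+1 (sym ∑∑dMid+m+m²≡) ⟩
    (∑∑dMid + m + m * m) + (m + 1) * m + (∑∑dMid + m + m * m) + ((∑∑dMid + m + m * m) + ∑∑dMid) + 4 * m + 4 * (m * m)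
      ≡⟨ collect ∑∑dMid m ⟩
    4 * ((∑∑dMid + m + m * m) + (m + 1) * m)
      ≡⟨ cong (λ t → 4 * (t + (m + 1) * m)) ∑∑dMid+m+m²≡ ⟩
    4 * (∑∑dToEdge + (m + 1) * m)
      ≡⟨ cong (λ x → 4 * (∑∑dToEdge + x * m)) (sym n≡m+1) ⟩
    4 * (∑∑dToEdge + n * m)
      ≡⟨ cong (4 *_) ∑∑dToEdge+nm≡ ⟩
    4 * (2 * ∑∑d)
      ≡⟨ sym (*-assoc 4 2 ∑∑d) ⟩
    8 * ∑∑d ∎
    where
    open ≡-Reasoning
    collect : ∀ x m → (x + m + m * m) + (m + 1) * m + (x + m + m * m) + ((x + m + m * m) + x) + 4 * m + 4 * (m * m)
                    ≡ 4 * ((x + m + m * m) + (m + 1) * m)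
    collect = solve-∀

module GeodesicDistance where

  open import Data.Nat using (ℕ; zero; suc; _+_; _*_; _∸_; _^_; _<ᵇ_)
  open import Data.Nat.Properties using (+-cancelʳ-≡; *-cancelˡ-≡; *-assoc; *-identityˡ; m+n∸n≡m)
  open import Data.Nat.Tactic.RingSolver using (solve-∀)
  open import Data.Bool using (if_then_else_)
  open import Data.Fin using (toℕ; fromℕ<; _↑ˡ_)
  open import Data.List using (length; map; allFin)
  open import Data.List.Properties using (map-cong)
  open import Data.Nat.ListAction using () renaming (sum to sumˡ)
  open import Data.Product using (proj₁)
  open import Relation.Binary.PropositionalEquality

  open Sums
  open TreeDistances
  open Trees

  module _ {G : Graph} (τ : TreeDistance G) where
    open TreeDistanceProperties τ

    2*geodesicDistance : 2 * geodesicDistance G ≡ ∑[ u < n ] ∑[ v < n ] d u v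
    2*geodesicDistance = cong (2 *_) geodesicDistance≡ ∙ 2*∑∑<≡∑∑ n d d-sym d-self
      where
      upper : Vertex G → Vertex G → ℕ
      upper u v = if toℕ u <ᵇ toℕ v then d u v else 0
      geodesicDistance≡ : geodesicDistance G ≡ ∑[ u < n ] ∑[ v < n ] upper u v
      geodesicDistance≡ = cong sumˡ (map-cong row (allFin n)) ∙ sumˡ-allFin n (λ u → ∑[ v < n ] upper u v)
        where
        row : ∀ u → sumˡ (map (λ v → if toℕ u <ᵇ toℕ v then dist G u v else 0) (allFin n)) ≡ ∑[ v < n ] upper u v
        row u = sumˡ-allFin n _ ∙ sum-cong-≗ (λ v → cong (λ x → if toℕ u <ᵇ toℕ v then x else 0) (dist≡d u v))

  module _ {G : Graph} (τ : TreeDistance G) (y : Vertex G) where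
    open TreeDistanceProperties τ
    open Subdivision τ using (S; old; subdivide-treeDistance)
    open WienerStep τ using (∑∑d'-subdivide)

    geodesicDistance-subdivide : geodesicDistance S + 2 * m + 2 * (m * m) ≡ 8 * geodesicDistance G
    geodesicDistance-subdivide = *-cancelˡ-≡ _ _ 2 (begin
      2 * (geodesicDistance S + 2 * m + 2 * (m * m))   ≡⟨ distribute (geodesicDistance S) m ⟩
      2 * geodesicDistance S + 4 * m + 4 * (m * m)     ≡⟨ cong (λ x → x + 4 * m + 4 * (m * m)) (2*geodesicDistance subdivide-treeDistance) ⟩
      _                                                ≡⟨ ∑∑d'-subdivide (order≡size+1 y) ⟩
      8 * ∑[ u < n ] ∑[ v < n ] d u v                  ≡⟨ cong (8 *_) (sym (2*geodesicDistance τ)) ⟩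
      8 * (2 * geodesicDistance G)                     ≡⟨ trans (sym (*-assoc 8 2 (geodesicDistance G))) (*-assoc 2 8 (geodesicDistance G)) ⟩
      2 * (8 * geodesicDistance G)                     ∎)
      where
      open ≡-Reasoning
      distribute : ∀ g m → 2 * (g + 2 * m + 2 * (m * m)) ≡ 2 * g + 4 * m + 4 * (m * m)
      distribute = solve-∀

    size-subdivide : length (edges S) ≡ 2 * m
    size-subdivide = +-cancelʳ-≡ 1 _ _ (trans (sym (TreeDistanceProperties.order≡size+1 subdivide-treeDistance (old y)))
                                              (trans (cong (_+ m) (order≡size+1 y)) (regroup m)))
      where regroup : ∀ m → m + 1 + m ≡ 2 * m + 1
            regroup = solve-∀

    size≡order∸1 : m ≡ order G ∸ 1
    size≡order∸1 = sym (trans (cong (_∸ 1) (order≡size+1 y)) (m+n∸n≡m m 1))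

  module Iteration (T : Graph) (tree : IsTree T) where
    treeDistance : ∀ t → TreeDistance (iterSubdivide t T)
    treeDistance zero = tree⇒treeDistance T tree
    treeDistance (suc t) = Subdivision.subdivide-treeDistance (treeDistance t)

    root : ∀ t → Vertex (iterSubdivide t T)
    root zero = fromℕ< (proj₁ tree)
    root (suc t) = root t ↑ˡ _

    size : ℕ → ℕ
    size t = length (edges (iterSubdivide t T))

    geodesic : ℕ → ℕ
    geodesic t = geodesicDistance (iterSubdivide t T)

    size≡ : ∀ t → size t ≡ 2 ^ t * (order T ∸ 1)
    size≡ zero = trans (size≡order∸1 (treeDistance 0) (root 0)) (sym (*-identityˡ _))
    size≡ (suc t) = trans (size-subdivide (treeDistance t) (root t)) (trans (cong (2 *_) (size≡ t)) (sym (*-assoc 2 (2 ^ t) _)))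

    geodesic-step : ∀ t → geodesic (suc t) + 2 * size t + 2 * (size t * size t) ≡ 8 * geodesic t
    geodesic-step t = geodesicDistance-subdivide (treeDistance t) (root t)

open import Data.Nat using (ℕ; zero; suc; _^_; _∸_)
import Data.Nat as ℕ
import Data.Nat.Properties as ℕ
open import Data.Nat.Coprimality using (1-coprimeTo)
import Data.Nat.Coprimality as Coprimality
open import Data.Integer using (+_)
import Data.Integer as ℤ
import Data.Integer.Properties as ℤ
open import Data.Rational using (ℚ; _/_; _+_; _-_; _*_; mkℚ)
open import Data.Rational.Properties using (↥p/↧p≡p; /-cong)
open import Data.Rational.Solver using (module +-*-Solver)
open import Relation.Binary.PropositionalEquality

open GeodesicDistance using (module Iteration)

open +-*-Solver

ι : ℕ → ℚ
ι x = + x / 1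

private
  ι≡mkℚ : ∀ x → ι x ≡ mkℚ (+ x) 0 (Coprimality.sym (1-coprimeTo x))
  ι≡mkℚ x = ↥p/↧p≡p (mkℚ (+ x) 0 (Coprimality.sym (1-coprimeTo x)))

ι-+ : ∀ x y → ι (x ℕ.+ y) ≡ ι x + ι y
ι-+ x y rewrite ι≡mkℚ x | ι≡mkℚ y =
  /-cong {+ (x ℕ.+ y)} {1} (sym (cong₂ ℤ._+_ (ℤ.*-identityʳ (+ x)) (ℤ.*-identityʳ (+ y)))) refl

ι-* : ∀ x y → ι (x ℕ.* y) ≡ ι x * ι y
ι-* x y rewrite ι≡mkℚ x | ι≡mkℚ y = /-cong {+ (x ℕ.* y)} {1} (ℤ.pos-* x y) refl

ι-2^[k*1+t] : ∀ k t → ι (2 ^ (k ℕ.* suc t)) ≡ ι (2 ^ k) * ι (2 ^ (k ℕ.* t))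
ι-2^[k*1+t] k t =
  trans (cong (λ s → ι (2 ^ s)) (ℕ.*-suc k t)) (trans (cong ι (ℕ.^-distribˡ-+-* 2 k (k ℕ.* t))) (ι-* (2 ^ k) (2 ^ (k ℕ.* t))))

ι-2^[2*t] : ∀ t → ι (2 ^ (2 ℕ.* t)) ≡ ι (2 ^ t) * ι (2 ^ t)
ι-2^[2*t] t =
  trans (cong (λ s → ι (2 ^ (t ℕ.+ s))) (ℕ.+-identityʳ t)) (trans (cong ι (ℕ.^-distribˡ-+-* 2 t t)) (ι-* (2 ^ t) (2 ^ t)))

module ClosedForm (W₀ M : ℚ) where

  -- The right-hand side of the theorem, with 8^t, 2^(3t), 2^(2t), 2^t abstracted to X, Y, Z, a.
  Φ : ℚ → ℚ → ℚ → ℚ → ℚ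
  Φ X Y Z a = (X * W₀ - (+ 1 / 3) * (Y - a) * M) + ((+ 1 / 2) * (Z - Y)) * (M * M)

  Φ-zero : W₀ ≡ Φ (ι 1) (ι 1) (ι 1) (ι 1)
  Φ-zero = solve 2 (λ W₀ M → W₀ := (con (ι 1) :* W₀ :- con (+ 1 / 3) :* (con (ι 1) :- con (ι 1)) :* M)
                                    :+ (con (+ 1 / 2) :* (con (ι 1) :- con (ι 1))) :* (M :* M)) refl W₀ M

  -- The recursion w' = 8 w - 2 s - 2 s² of a subdivision, for s = a M edges.
  Φ-step : ∀ (w w' X Y a s : ℚ) → s ≡ a * M → w' + ι 2 * s + ι 2 * (s * s) ≡ ι 8 * w → w ≡ Φ X Y (a * a) a →
           w' ≡ Φ (ι 8 * X) (ι 8 * Y) (ι 4 * (a * a)) (ι 2 * a)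
  Φ-step w w' X Y a s s≡aM step hyp = begin
    w'                                                      ≡⟨ isolate w' s ⟩
    (w' + ι 2 * s + ι 2 * (s * s)) - ι 2 * s - ι 2 * (s * s) ≡⟨ cong (λ v → v - ι 2 * s - ι 2 * (s * s)) step ⟩
    ι 8 * w - ι 2 * s - ι 2 * (s * s)                       ≡⟨ cong (λ v → ι 8 * v - ι 2 * s - ι 2 * (s * s)) hyp ⟩
    ι 8 * Φ X Y (a * a) a - ι 2 * s - ι 2 * (s * s)         ≡⟨ cong (λ v → ι 8 * Φ X Y (a * a) a - ι 2 * v - ι 2 * (v * v)) s≡aM ⟩
    ι 8 * Φ X Y (a * a) a - ι 2 * (a * M) - ι 2 * ((a * M) * (a * M))
                                                            ≡⟨ expand X Y a ⟩
    Φ (ι 8 * X) (ι 8 * Y) (ι 4 * (a * a)) (ι 2 * a)         ∎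
    where
    open ≡-Reasoning
    isolate : ∀ w' s → w' ≡ (w' + ι 2 * s + ι 2 * (s * s)) - ι 2 * s - ι 2 * (s * s)
    isolate = solve 2 (λ w' s → w' := (w' :+ con (ι 2) :* s :+ con (ι 2) :* (s :* s)) :- con (ι 2) :* s :- con (ι 2) :* (s :* s))
                      refl
    expand : ∀ X Y a → ι 8 * Φ X Y (a * a) a - ι 2 * (a * M) - ι 2 * ((a * M) * (a * M))
                       ≡ Φ (ι 8 * X) (ι 8 * Y) (ι 4 * (a * a)) (ι 2 * a)
    expand = solve 5 (λ W₀ M X Y a →
        con (ι 8) :* ((X :* W₀ :- con (+ 1 / 3) :* (Y :- a) :* M) :+ (con (+ 1 / 2) :* (a :* a :- Y)) :* (M :* M))
          :- con (ι 2) :* (a :* M) :- con (ι 2) :* ((a :* M) :* (a :* M))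
        := ((con (ι 8) :* X) :* W₀ :- con (+ 1 / 3) :* (con (ι 8) :* Y :- con (ι 2) :* a) :* M)
          :+ (con (+ 1 / 2) :* (con (ι 4) :* (a :* a) :- con (ι 8) :* Y)) :* (M :* M)) refl W₀ M

  Φ-cong : ∀ {X X' Y Y' Z Z' a a'} → X ≡ X' → Y ≡ Y' → Z ≡ Z' → a ≡ a' → Φ X Y Z a ≡ Φ X' Y' Z' a'
  Φ-cong refl refl refl refl = refl

module _ (T : Graph) (tree : IsTree T) where
  open Iteration T tree

  ι-size : ∀ t → ι (size t) ≡ ι (2 ^ t) * ι (order T ∸ 1)
  ι-size t = trans (cong ι (size≡ t)) (ι-* (2 ^ t) (order T ∸ 1))

  ι-geodesic-step : ∀ t → ι (geodesic (suc t)) + ι 2 * ι (size t) + ι 2 * (ι (size t) * ι (size t)) ≡ ι 8 * ι (geodesic t)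
  ι-geodesic-step t = begin
    ι (geodesic (suc t)) + ι 2 * ι (size t) + ι 2 * (ι (size t) * ι (size t))
      ≡⟨ sym (cong₂ _+_ (trans (ι-+ (geodesic (suc t)) (2 ℕ.* size t)) (cong (λ s → ι (geodesic (suc t)) + s) (ι-* 2 (size t))))
                        (trans (ι-* 2 (size t ℕ.* size t)) (cong (ι 2 *_) (ι-* (size t) (size t))))) ⟩
    ι (geodesic (suc t) ℕ.+ 2 ℕ.* size t) + ι (2 ℕ.* (size t ℕ.* size t))
      ≡⟨ sym (ι-+ (geodesic (suc t) ℕ.+ 2 ℕ.* size t) (2 ℕ.* (size t ℕ.* size t))) ⟩
    ι (geodesic (suc t) ℕ.+ 2 ℕ.* size t ℕ.+ 2 ℕ.* (size t ℕ.* size t))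
      ≡⟨ cong ι (geodesic-step t) ⟩
    ι (8 ℕ.* geodesic t)
      ≡⟨ ι-* 8 (geodesic t) ⟩
    ι 8 * ι (geodesic t) ∎
    where open ≡-Reasoning

mainTheorem2 : (T : Graph) → IsTree T → (t : ℕ) →
    (+ geodesicDistance (iterSubdivide t T) / 1)
      ≡ ((+ (8 ^ t) / 1) * (+ geodesicDistance T / 1)
         - (+ 1 / 3) * ((+ (2 ^ (3 Data.Nat.* t)) / 1) - (+ (2 ^ t) / 1)) * (+ (order T ∸ 1) / 1))
        + ((+ 1 / 2) * ((+ (2 ^ (2 Data.Nat.* t)) / 1) - (+ (2 ^ (3 Data.Nat.* t)) / 1)))
          * ((+ (order T ∸ 1) / 1) * (+ (order T ∸ 1) / 1))
mainTheorem2 T tree zero = ClosedForm.Φ-zero (ι (geodesicDistance T)) (ι (order T ∸ 1))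
mainTheorem2 T tree (suc t) =
  trans (Φ-step (ι (geodesic t)) (ι (geodesic (suc t))) X Y a (ι (size t)) (ι-size T tree t) (ι-geodesic-step T tree t)
                (trans (mainTheorem2 T tree t) (cong (λ Z → Φ X Y Z a) (ι-2^[2*t] t))))
        (Φ-cong (sym (ι-* 8 (8 ^ t))) (sym (ι-2^[k*1+t] 3 t)) (sym (trans (ι-2^[k*1+t] 2 t) (cong (ι 4 *_) (ι-2^[2*t] t))))
                (sym (ι-* 2 (2 ^ t))))
  where
  open Iteration T tree using (geodesic; size)
  open ClosedForm (ι (geodesicDistance T)) (ι (order T ∸ 1))
  X Y a : ℚ
  X = ι (8 ^ t)
  Y = ι (2 ^ (3 ℕ.* t))
  a = ι (2 ^ t)
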